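{- Let $n\geq 3$ and let $D_n=\langle a,b\mid a^n=b^2=1,\ ab=ba^{ -1}\rangle$. For a positive divisor $r$ of $n$ and $1\le i\le n/r$ let $H_i^r=\langle a^{n/r}, ba^{i-1}\rangle$, and let $x_i^r$ be the number of pairs $(s,j)$ with $s$ a positive divisor of $n$, $1\le j\le n/s$, such that $\frac{n}{\mathrm{lcm}(r,s)}$ divides $2(i-j)$. (i) If $n$ is odd, then $\deg_{\Gamma_N(D_n)}(H_i^r)=x_i^r-2$ for every divisor $r$ of $n$ with $r\neq n$ and every $i=1,\dots,n/r$. (ii) If $n$ is even, then $\deg_{\Gamma_N(D_n)}(H_i^r)=x_i^r-4$ for every divisor $r$ of $n$ with $r\neq n, \frac n2$ and every $i=1,\dots,n/r$.
   Context: $\Gamma_N(G)$ denotes the simple graph whose vertices are the proper non-normal subgroups of $G$, two distinct vertices $H,K$ being adjacent iff $HK=KH$. The subgroups $H_i^r$ ($r\mid n$, $1\le i\le n/r$) are exactly the subgroups of $D_n$ not contained in $\langle a\rangle$ (note $H_1^n=D_n$); two of them, $H_i^r$ and $H_j^s$, permute iff $\frac{n}{\mathrm{lcm}(r,s)}\mid 2(i-j)$. -}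

module Defs where

open import Data.Bool using (Bool; true; false; _∧_; _∨_; not; if_then_else_; _xor_)
open import Data.Nat using (ℕ; zero; suc; _+_; _*_; _∸_; _≤ᵇ_)
open import Data.Nat.DivMod using (_/_; _mod_)
open import Data.Nat.LCM using (lcm)
open import Data.Nat.Divisibility using (_∣?_)
open import Data.Integer as ℤ using (ℤ; +_; ∣_∣)
open import Data.Fin as Fin using (Fin; toℕ)
open import Data.Vec as Vec using (Vec; []; _∷_; lookup; tabulate)
open import Data.List as List using (List; []; _∷_; _++_; map; concatMap; filter; length; allFin; upTo)
open import Data.Bool.ListAction using (all; any)
open import Data.Bool using (T?)
open import Data.Product using (_×_; _,_; proj₁; proj₂)
open import Relation.Nullary.Decidable using (⌊_⌋)
import Data.Bool.Properties as BoolP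

-- The dihedral group D_n = ⟨a, b | aⁿ = b² = 1, ab = ba⁻¹⟩ of order 2n.
-- The element (e , k) stands for bᵉ aᵏ  (e ∈ {0,1} as Bool, k ∈ ℤ/nℤ as Fin n).

El : ℕ → Set
El n = Bool × Fin n

addF : {n : ℕ} → Fin n → Fin n → Fin n
addF {suc m} x y = (toℕ x + toℕ y) mod suc m

negF : {n : ℕ} → Fin n → Fin n
negF {suc m} x = (suc m ∸ toℕ x) mod suc m

expF : (m k : ℕ) → Fin (suc m)
expF m k = k mod suc m

-- (bᵉ aᵏ)(bᶠ aˡ) = b^(e+f) a^((-1)ᶠ k + l)   (using aᵏ b = b a⁻ᵏ)
mul : {n : ℕ} → El n → El n → El n
mul (e , k) (f , l) = (e xor f , addF (if f then negF k else k) l)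

inv : {n : ℕ} → El n → El n
inv (false , k) = (false , negF k)
inv (true  , k) = (true  , k)

one : {m : ℕ} → El (suc m)
one = (false , Fin.zero)

eqEl : {n : ℕ} → El n → El n → Bool
eqEl (e , k) (f , l) = ⌊ e BoolP.≟ f ⌋ ∧ ⌊ k Fin.≟ l ⌋

elems : (n : ℕ) → List (El n)
elems n = map (false ,_) (allFin n) ++ map (true ,_) (allFin n)

-- Subsets of D_n: a pair of characteristic vectors (rotations aᵏ, reflections baᵏ).

Sub : ℕ → Set
Sub n = Vec Bool n × Vec Bool n

mem : {n : ℕ} → Sub n → El n → Bool
mem S (false , k) = lookup (proj₁ S) k
mem S (true  , k) = lookup (proj₂ S) k

fromPred : {n : ℕ} → (El n → Bool) → Sub n
fromPred P = (tabulate (λ k → P (false , k)) , tabulate (λ k → P (true , k)))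

eqSub : {n : ℕ} → Sub n → Sub n → Bool
eqSub {n} S T = all (λ x → ⌊ mem S x BoolP.≟ mem T x ⌋) (elems n)

allVecs : (n : ℕ) → List (Vec Bool n)
allVecs zero    = [] ∷ []
allVecs (suc n) = concatMap (λ v → (false ∷ v) ∷ (true ∷ v) ∷ []) (allVecs n)

allSubs : (n : ℕ) → List (Sub n)
allSubs n = concatMap (λ u → map (u ,_) (allVecs n)) (allVecs n)

isSubgroup : {n : ℕ} → Sub n → Bool
isSubgroup {zero}  S = false
isSubgroup {suc m} S =
  mem S one
  ∧ all (λ x → not (mem S x) ∨ mem S (inv x)) (elems (suc m))
  ∧ all (λ x → all (λ y → not (mem S x ∧ mem S y) ∨ mem S (mul x y)) (elems (suc m))) (elems (suc m))

isProper : {n : ℕ} → Sub n → Bool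
isProper {n} S = not (all (mem S) (elems n))

isNormal : {n : ℕ} → Sub n → Bool
isNormal {n} S =
  all (λ g → all (λ h → not (mem S h) ∨ mem S (mul (mul g h) (inv g))) (elems n)) (elems n)

inProd : {n : ℕ} → Sub n → Sub n → El n → Bool
inProd {n} H K x =
  any (λ h → any (λ k → mem H h ∧ mem K k ∧ eqEl (mul h k) x) (elems n)) (elems n)

permutes : {n : ℕ} → Sub n → Sub n → Bool
permutes {n} H K = all (λ x → ⌊ inProd H K x BoolP.≟ inProd K H x ⌋) (elems n)

-- The graph Γ_N(D_n): vertices = proper non-normal subgroups; H ~ K iff H ≠ K and HK = KH.

isVertex : {n : ℕ} → Sub n → Bool
isVertex S = isSubgroup S ∧ isProper S ∧ not (isNormal S)

adjacent : {n : ℕ} → Sub n → Sub n → Bool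
adjacent H K = not (eqSub H K) ∧ permutes H K

degΓN : (n : ℕ) → Sub n → ℕ
degΓN n H = length (filter (λ K → T? (isVertex K ∧ adjacent H K)) (allSubs n))

-- Subgroup generated by a list of elements: iterate S ↦ S ∪ S⁻¹ ∪ S·S starting
-- from {1} ∪ gens.  Each non-stable step adds an element, so 2n steps reach the
-- closure, i.e. the subgroup ⟨gens⟩.

closeStep : {n : ℕ} → Sub n → Sub n
closeStep {n} S = fromPred (λ x →
  mem S x ∨ mem S (inv x)
  ∨ any (λ y → any (λ z → mem S y ∧ mem S z ∧ eqEl (mul y z) x) (elems n)) (elems n))

iter : {A : Set} → ℕ → (A → A) → A → A
iter zero    f a = a
iter (suc k) f a = f (iter k f a)

generated : {m : ℕ} → List (El (suc m)) → Sub (suc m)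
generated {m} gs =
  iter (2 * suc m) closeStep (fromPred (λ x → eqEl x one ∨ any (eqEl x) gs))

-- H_i^r = ⟨ a^(n/r), b a^(i-1) ⟩  (for n ≥ 1, r ≥ 1; dummy empty set otherwise)
H : (n r i : ℕ) → Sub n
H zero    r       i = ([] , [])
H (suc m) zero    i = fromPred (λ _ → false)
H (suc m) (suc r') i =
  generated ((false , expF m (suc m / suc r')) ∷ (true , expF m (i ∸ 1)) ∷ [])

-- Integer divisibility d ∣ z is (by the library definition) ∣d∣ ∣ ∣z∣ in ℕ.

divN : ℕ → ℕ → ℕ
divN n zero     = zero
divN n (suc d)  = n / suc d

range1 : ℕ → List ℕ
range1 k = map suc (upTo k)

pairs : ℕ → List (ℕ × ℕ)
pairs n = concatMap (λ s → if ⌊ s ∣? n ⌋ then map (s ,_) (range1 (divN n s)) else [])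
                    (range1 n)

x : (n r i : ℕ) → ℕ
x n r i = length (filter (λ p → divN n (lcm r (proj₁ p))
                                  ∣? ∣ + 2 ℤ.* (+ i ℤ.- + proj₂ p) ∣)
                         (pairs n))

module Submission where

-- Every subgroup of D_n containing a reflection is ⟨a^D, b a^c⟩ for a divisor D of n and an
-- offset 0 ≤ c < D (Classification); it is proper iff D ≥ 2 and normal iff D ∣ 2, while the
-- subgroups of ⟨a⟩ are normal (Dihedral).  So the vertices of Γ_N(D_n) are the ⟨a^D, b a^c⟩
-- with D ≥ 3, and they correspond bijectively to the pairs (s , j) counted by x_i^r, through
-- D = n/s and c = j - 1.  Two such subgroups permute iff gcd(D, E) ∣ 2(c' - c) (Products), and
-- for D = n/r, E = n/s this gcd is n / lcm(r, s) (Cofactor).  Hence the neighbours of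
-- H_i^r = ⟨a^(n/r), b a^(i-1)⟩ (Generation) are counted by the pairs satisfying the
-- divisibility condition of x_i^r, except (r , i) itself and the pairs with n/s ≤ 2, namely
-- (n , 1) and, for even n, (n/2 , 1) and (n/2 , 2) (Neighbours).

module Development where

  open import Defs
  open import Data.Bool using (Bool; true; false; T; not; _∧_; _∨_; _xor_; if_then_else_)
  import Data.Bool.Properties as BoolP
  open import Data.Bool.ListAction using (all; any)
  open import Data.Empty using (⊥-elim)
  open import Data.Nat as ℕ using (ℕ; zero; suc; _≤_; _<_; z≤n; s≤s)
  import Data.Nat.Properties as ℕP
  import Data.Nat.Divisibility as ℕ
  open import Data.Nat.DivMod using (_%_; _/_; _mod_; m≡m%n+[m/n]*n; m%n<n; m/n*n≡m; n/1≡n; n/n≡1; m/n<m)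
  open import Data.Nat.GCD using (gcd; module Bézout; gcd-GCD; gcd[m,n]∣m; gcd[m,n]∣n; gcd-greatest)
  open import Data.Nat.LCM using (lcm; m∣lcm[m,n]; n∣lcm[m,n]; lcm-least)
  open import Data.Integer as ℤ using (ℤ; +_; _+_; _-_; -_; _*_; ∣_∣)
  import Data.Integer.Properties as ℤP
  import Data.Integer.DivMod as ℤ
  open import Data.Integer.Divisibility.Signed
  open import Data.Integer.Tactic.RingSolver using (solve-∀)
  open import Data.Fin as Fin using (Fin; toℕ; fromℕ<)
  import Data.Fin.Properties as FinP
  open import Data.Vec as Vec using (Vec; []; _∷_)
  open import Data.Vec.Properties using (lookup∘tabulate; tabulate∘lookup; tabulate-cong)
  open import Data.List using (List; []; _∷_; _++_; map; concatMap; filter; length)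
  open import Data.List.Properties using (length-map; length-++)
  open import Data.List.Membership.Propositional using (_∈_; find; lose)
  open import Data.List.Membership.Propositional.Properties
  open import Data.List.Membership.Propositional.Properties.WithK using (unique∧set⇒bag)
  open import Data.List.Relation.Binary.BagAndSetEquality using (∼bag⇒↭)
  open import Data.List.Relation.Binary.Permutation.Propositional.Properties using (↭-length)
  open import Data.List.Relation.Unary.Any using (here; there)
  import Data.List.Relation.Unary.Any.Properties as Any
  open import Data.List.Relation.Unary.All as All using (All; []; _∷_)
  import Data.List.Relation.Unary.All.Properties as All
  open import Data.List.Relation.Unary.AllPairs using ([]; _∷_)
  open import Data.List.Relation.Unary.Unique.Propositional using (Unique)
  import Data.List.Relation.Unary.Unique.Propositional.Properties as Unique
  open import Data.Product using (∃; ∃₂; _×_; _,_; proj₁; proj₂)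
  import Data.Product.Properties as ProductP
  open import Data.Sum using (_⊎_; inj₁; inj₂)
  open import Function.Bundles using (_⇔_; mk⇔; Equivalence)
  open import Relation.Nullary using (¬_; Dec; yes; no)
  open import Relation.Nullary.Decidable using (⌊_⌋; toWitness; fromWitness; map′; T?; _×-dec_; ¬?)
  open import Relation.Unary using (Decidable)
  open import Relation.Binary.Bundles using (Setoid)
  open import Relation.Binary.PropositionalEquality using (_≡_; _≢_; refl; sym; trans; cong; cong₂; subst)
  open import Relation.Binary.PropositionalEquality.Properties using (module ≡-Reasoning)
  import Relation.Binary.Reasoning.Setoid

  T-not⁺ : {b : Bool} → ¬ T b → T (not b)
  T-not⁺ {true}  ¬b = ¬b _
  T-not⁺ {false} _  = _

  T-not⁻ : {b : Bool} → T (not b) → ¬ T b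
  T-not⁻ {true} () _

  T-ext : {a b : Bool} → (T a → T b) → (T b → T a) → a ≡ b
  T-ext {true}  {true}  _ _ = refl
  T-ext {true}  {false} f _ = ⊥-elim (f _)
  T-ext {false} {true}  _ g = ⊥-elim (g _)
  T-ext {false} {false} _ _ = refl

  module _ {A : Set} {p : A → Bool} where

    T-all⁻ : {xs : List A} → T (all p xs) → ∀ {x} → x ∈ xs → T (p x)
    T-all⁻ {xs} t = All.lookup (All.all⁺ p xs t)

    T-all⁺ : {xs : List A} → (∀ {x} → x ∈ xs → T (p x)) → T (all p xs)
    T-all⁺ f = All.all⁻ p (All.tabulate f)

    T-any⁻ : {xs : List A} → T (any p xs) → ∃ λ x → x ∈ xs × T (p x)
    T-any⁻ {xs} t = find (Any.any⁻ p xs t)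

    T-any⁺ : {xs : List A} {x : A} → x ∈ xs → T (p x) → T (any p xs)
    T-any⁺ x∈ px = Any.any⁺ p (lose x∈ px)

  -- Boolean connectives as propositions.  The first operand is explicit: T is not
  -- injective, so it cannot be recovered from a type T (a ∧ b).
  T-⇒⁻ : ∀ a {b} → T (not a ∨ b) → T a → T b
  T-⇒⁻ true t _ = t

  T-⇒⁺ : ∀ a {b} → (T a → T b) → T (not a ∨ b)
  T-⇒⁺ true  f = f _
  T-⇒⁺ false _ = _

  T-∧⁻ : ∀ a {b} → T (a ∧ b) → T a × T b
  T-∧⁻ a = Equivalence.to (BoolP.T-∧ {a})

  T-∧⁺ : ∀ a {b} → T a → T b → T (a ∧ b)
  T-∧⁺ a ta tb = Equivalence.from (BoolP.T-∧ {a}) (ta , tb)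

  T-∨⁻ : ∀ a {b} → T (a ∨ b) → T a ⊎ T b
  T-∨⁻ a = Equivalence.to (BoolP.T-∨ {a})

  T-∨⁺ˡ : ∀ a {b} → T a → T (a ∨ b)
  T-∨⁺ˡ a ta = Equivalence.from (BoolP.T-∨ {a}) (inj₁ ta)

  T-∨⁺ʳ : ∀ a {b} → T b → T (a ∨ b)
  T-∨⁺ʳ a tb = Equivalence.from (BoolP.T-∨ {a}) (inj₂ tb)

  length-unique : {A : Set} {xs ys : List A} → Unique xs → Unique ys →
    (∀ {z} → z ∈ xs ⇔ z ∈ ys) → length xs ≡ length ys
  length-unique ux uy eq = ↭-length (∼bag⇒↭ (unique∧set⇒bag ux uy eq))

  map-unique : {A B : Set} (f : A → B) {xs : List A} →
    (∀ {a b} → a ∈ xs → b ∈ xs → f a ≡ f b → a ≡ b) → Unique xs → Unique (map f xs)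
  map-unique f {[]}     _   []       = []
  map-unique f {x ∷ xs} inj (x∉ ∷ u) =
    fresh xs (λ b∈ → inj (here refl) (there b∈)) x∉ ∷
      map-unique f (λ a∈ b∈ → inj (there a∈) (there b∈)) u
    where
    fresh : ∀ ys → (∀ {b} → b ∈ ys → f x ≡ f b → x ≡ b) → All (x ≢_) ys → All (f x ≢_) (map f ys)
    fresh []       _    []         = []
    fresh (y ∷ ys) injy (x≢y ∷ ps) = (λ e → x≢y (injy (here refl) e)) ∷
      fresh ys (λ b∈ → injy (there b∈)) ps

  concatMap-unique : {A B : Set} (π : B → A) (h : A → List B) {S : List A} → Unique S →
    (∀ s → Unique (h s)) → (∀ s {z} → z ∈ h s → π z ≡ s) → Unique (concatMap h S)
  concatMap-unique π h {[]}    []        _  _  = []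
  concatMap-unique π h {s ∷ S} (s∉ ∷ u) uh hπ =
    Unique.++⁺ (uh s) (concatMap-unique π h u uh hπ) disjoint
    where
    disjoint : ∀ {v} → ¬ (v ∈ h s × v ∈ concatMap h S)
    disjoint {v} (v∈s , v∈S) with find (∈-concatMap⁻ h {xs = S} v∈S)
    ... | t , t∈S , v∈t = All.lookup s∉ t∈S (trans (sym (hπ s v∈s)) (hπ t v∈t))

  module _ {A B : Set} {Q : A → Set} {R : B → Set} (Q? : Decidable Q) (R? : Decidable R) where

    length-filter-image : (f : A → B) {xs : List A} {ys : List B} →
      Unique xs → Unique ys → (∀ y → y ∈ ys) →
      (∀ {a b} → a ∈ xs → b ∈ xs → f a ≡ f b → a ≡ b) →
      (∀ {y} → R y → ∃ λ a → a ∈ xs × Q a × y ≡ f a) →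
      (∀ {a} → a ∈ xs → Q a → R (f a)) →
      length (filter R? ys) ≡ length (filter Q? xs)
    length-filter-image f {xs} {ys} uxs uys complete inj onto into =
      trans (length-unique (Unique.filter⁺ R? uys) (map-unique f inj-Q (Unique.filter⁺ Q? uxs)) (mk⇔ to from))
            (length-map f (filter Q? xs))
      where
      inj-Q : ∀ {a b} → a ∈ filter Q? xs → b ∈ filter Q? xs → f a ≡ f b → a ≡ b
      inj-Q a∈ b∈ = inj (proj₁ (∈-filter⁻ Q? {xs = xs} a∈)) (proj₁ (∈-filter⁻ Q? {xs = xs} b∈))
      to : ∀ {y} → y ∈ filter R? ys → y ∈ map f (filter Q? xs)
      to y∈ with onto (proj₂ (∈-filter⁻ R? {xs = ys} y∈))
      ... | a , a∈ , qa , refl = ∈-map⁺ f (∈-filter⁺ Q? a∈ qa)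
      from : ∀ {y} → y ∈ map f (filter Q? xs) → y ∈ filter R? ys
      from y∈ with ∈-map⁻ f y∈
      ... | a , a∈ , refl = let a∈xs , qa = ∈-filter⁻ Q? {xs = xs} a∈ in
        ∈-filter⁺ R? (complete (f a)) (into a∈xs qa)

  module _ {A : Set} {P Q : A → Set} (P? : Decidable P) (Q? : Decidable Q) where

    length-filter-split : {xs E : List A} → Unique xs → Unique E →
      (∀ {a} → a ∈ xs → Q a → P a) →
      (∀ {a} → a ∈ xs → P a → ¬ Q a → a ∈ E) →
      (∀ {a} → a ∈ E → a ∈ xs × P a × ¬ Q a) →
      length (filter P? xs) ≡ length (filter Q? xs) ℕ.+ length E
    length-filter-split {xs} {E} uxs uE Q⇒P exception exceptional =
      trans (length-unique (Unique.filter⁺ P? uxs) (Unique.++⁺ (Unique.filter⁺ Q? uxs) uE disjoint) (mk⇔ to from))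
            (length-++ (filter Q? xs))
      where
      disjoint : ∀ {a} → ¬ (a ∈ filter Q? xs × a ∈ E)
      disjoint (a∈Q , a∈E) = proj₂ (proj₂ (exceptional a∈E)) (proj₂ (∈-filter⁻ Q? {xs = xs} a∈Q))
      to : ∀ {a} → a ∈ filter P? xs → a ∈ filter Q? xs ++ E
      to {a} a∈ with ∈-filter⁻ P? {xs = xs} a∈ | Q? a
      ... | a∈xs , _  | yes qa = ∈-++⁺ˡ (∈-filter⁺ Q? a∈xs qa)
      ... | a∈xs , pa | no ¬qa = ∈-++⁺ʳ (filter Q? xs) (exception a∈xs pa ¬qa)
      from : ∀ {a} → a ∈ filter Q? xs ++ E → a ∈ filter P? xs
      from a∈ with ∈-++⁻ (filter Q? xs) a∈
      ... | inj₁ a∈Q = let a∈xs , qa = ∈-filter⁻ Q? {xs = xs} a∈Q in ∈-filter⁺ P? a∈xs (Q⇒P a∈xs qa)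
      ... | inj₂ a∈E = let a∈xs , pa , _ = exceptional a∈E in ∈-filter⁺ P? a∈xs pa

  least-witness : {P : ℕ → Set} → Decidable P → ∀ N → P N →
    ∃ λ t → P t × (∀ {u} → u ℕ.< t → ¬ P u)
  least-witness P? N pN with P? 0
  ... | yes p0 = 0 , p0 , λ ()
  least-witness P? zero    pN | no ¬p0 = ⊥-elim (¬p0 pN)
  least-witness P? (suc N) pN | no ¬p0 with least-witness (λ u → P? (suc u)) N pN
  ... | t , pt , below = suc t , pt , λ { {zero} _ → ¬p0 ; {suc u} (s≤s u<t) → below u<t }

  -- Congruence of integers modulo d, as a record so that a, b and d can be inferred.
  record _≡_[mod_] (a b d : ℤ) : Set where
    constructor cong-mod
    field divides-difference : d ∣ a - b
  open _≡_[mod_] public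

  infix 4 _≡_[mod_]

  ∣-zero : ∀ {d} → d ∣ + 0
  ∣-zero = ∣ᵤ⇒∣ (ℕ._∣0 _)

  ∣-self-difference : ∀ {d} a → d ∣ a - a
  ∣-self-difference {d} a = subst (d ∣_) (sym (ℤP.+-inverseʳ a)) ∣-zero

  module _ {d : ℤ} where

    ≡mod-reflexive : {a b : ℤ} → a ≡ b → a ≡ b [mod d ]
    ≡mod-reflexive {a} refl = cong-mod (∣-self-difference a)

    ≡mod-refl : {a : ℤ} → a ≡ a [mod d ]
    ≡mod-refl = ≡mod-reflexive refl

    ≡mod-sym : {a b : ℤ} → a ≡ b [mod d ] → b ≡ a [mod d ]
    ≡mod-sym {a} {b} (cong-mod d∣a-b) = cong-mod (subst (d ∣_) (lemma a b) (∣m⇒∣-m d∣a-b))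
      where lemma : ∀ a b → - (a - b) ≡ b - a
            lemma = solve-∀

    ≡mod-trans : {a b c : ℤ} → a ≡ b [mod d ] → b ≡ c [mod d ] → a ≡ c [mod d ]
    ≡mod-trans {a} {b} {c} (cong-mod p) (cong-mod q) = cong-mod (subst (d ∣_) (lemma a b c) (∣m∣n⇒∣m+n p q))
      where lemma : ∀ a b c → (a - b) + (b - c) ≡ a - c
            lemma = solve-∀

    ≡mod-setoid : Setoid _ _
    ≡mod-setoid = record
      { Carrier = ℤ ; _≈_ = λ a b → a ≡ b [mod d ]
      ; isEquivalence = record { refl = ≡mod-refl ; sym = ≡mod-sym ; trans = ≡mod-trans } }

    +-≡mod : {a b a' b' : ℤ} → a ≡ a' [mod d ] → b ≡ b' [mod d ] → a + b ≡ a' + b' [mod d ]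
    +-≡mod {a} {b} {a'} {b'} (cong-mod p) (cong-mod q) =
      cong-mod (subst (d ∣_) (lemma a b a' b') (∣m∣n⇒∣m+n p q))
      where lemma : ∀ a b a' b' → (a - a') + (b - b') ≡ (a + b) - (a' + b')
            lemma = solve-∀

    neg-≡mod : {a b : ℤ} → a ≡ b [mod d ] → - a ≡ - b [mod d ]
    neg-≡mod {a} {b} (cong-mod p) = cong-mod (subst (d ∣_) (lemma a b) (∣m⇒∣-m p))
      where lemma : ∀ a b → - (a - b) ≡ - a - - b
            lemma = solve-∀

    *-≡mod : (q : ℤ) {a b : ℤ} → a ≡ b [mod d ] → q * a ≡ q * b [mod d ]
    *-≡mod q {a} {b} (cong-mod p) = cong-mod (subst (d ∣_) (lemma q a b) (∣n⇒∣m*n q p))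
      where lemma : ∀ q a b → q * (a - b) ≡ q * a - q * b
            lemma = solve-∀

    ∣-resp-≡mod : {a b : ℤ} → a ≡ b [mod d ] → d ∣ a → d ∣ b
    ∣-resp-≡mod {a} {b} (cong-mod p) d∣a = subst (d ∣_) (lemma a b) (∣m∣n⇒∣m-n d∣a p)
      where lemma : ∀ a b → a - (a - b) ≡ b
            lemma = solve-∀

    +-multiple-≡mod : (a q : ℤ) → a + q * d ≡ a [mod d ]
    +-multiple-≡mod a q = cong-mod (subst (d ∣_) (lemma a q d) (∣n⇒∣m*n q ∣-refl))
      where lemma : ∀ a q d → q * d ≡ (a + q * d) - a
            lemma = solve-∀

  remainder-≡mod : ∀ {a r : ℤ} q d → a ≡ r + q * d → r ≡ a [mod d ]
  remainder-≡mod {r = r} q d refl = ≡mod-sym (+-multiple-≡mod r q)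

  ≡mod-weaken : {d e a b : ℤ} → e ∣ d → a ≡ b [mod d ] → a ≡ b [mod e ]
  ≡mod-weaken e∣d (cong-mod p) = cong-mod (∣-trans e∣d p)

  -- If a ≤ b < D and a ≡ b mod D, then D divides b ∸ a < D, so a = b.
  ≡mod-small-ordered : {D a b : ℕ} → a ≤ b → b < D → + a ≡ + b [mod + D ] → a ≡ b
  ≡mod-small-ordered {D} {a} {b} a≤b b<D (cong-mod p) =
    ℕP.≤-antisym a≤b (ℕP.m∸n≡0⇒m≤n (multiple-below D∣b∸a))
    where
    D∣b∸a : D ℕ.∣ b ℕ.∸ a
    D∣b∸a = subst (D ℕ.∣_) (trans (cong ∣_∣ (ℤP.m-n≡m⊖n a b)) (ℤP.∣⊖∣-≤ a≤b)) (∣⇒∣ᵤ p)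
    multiple-below : D ℕ.∣ b ℕ.∸ a → b ℕ.∸ a ≡ 0
    multiple-below D∣k with b ℕ.∸ a in eq
    ... | zero  = refl
    ... | suc k = ⊥-elim (ℕP.<⇒≱ (subst (_< D) eq (ℕP.≤-<-trans (ℕP.m∸n≤m b a) b<D)) (ℕ.∣⇒≤ D∣k))

  ≡mod-small : {D a b : ℕ} → a < D → b < D → + a ≡ + b [mod + D ] → a ≡ b
  ≡mod-small {D} {a} {b} a<D b<D a≡b with ℕP.≤-total a b
  ... | inj₁ a≤b = ≡mod-small-ordered a≤b b<D a≡b
  ... | inj₂ b≤a = sym (≡mod-small-ordered b≤a a<D (≡mod-sym a≡b))

  gcd-combination : ∀ D E → ∃₂ λ α β → + gcd D E ≡ α * + D + β * + E
  gcd-combination D E with Bézout.identity (gcd-GCD D E)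
  ... | Bézout.+- x y eq = + x , - + y , solve-with (ℤ-eq eq)
    where
    ℤ-eq : gcd D E ℕ.+ y ℕ.* E ≡ x ℕ.* D → + gcd D E + + y * + E ≡ + x * + D
    ℤ-eq e = trans (sym (cong (λ w → + gcd D E + w) (ℤP.pos-* y E))) (trans (sym (ℤP.pos-+ (gcd D E) _))
               (trans (cong +_ e) (ℤP.pos-* x D)))
    solve-with : + gcd D E + + y * + E ≡ + x * + D → + gcd D E ≡ + x * + D + - + y * + E
    solve-with e = trans (lemma (+ gcd D E) (+ y) (+ E)) (cong (_+ - + y * + E) e)
      where lemma : ∀ g y e → g ≡ (g + y * e) + - y * e
            lemma = solve-∀
  ... | Bézout.-+ x y eq = - + x , + y , solve-with (ℤ-eq eq)
    where
    ℤ-eq : gcd D E ℕ.+ x ℕ.* D ≡ y ℕ.* E → + gcd D E + + x * + D ≡ + y * + E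
    ℤ-eq e = trans (sym (cong (λ w → + gcd D E + w) (ℤP.pos-* x D))) (trans (sym (ℤP.pos-+ (gcd D E) _))
               (trans (cong +_ e) (ℤP.pos-* y E)))
    solve-with : + gcd D E + + x * + D ≡ + y * + E → + gcd D E ≡ - + x * + D + + y * + E
    solve-with e = trans (lemma (+ gcd D E) (+ x) (+ D)) (cong (λ w → - + x * + D + w) e)
      where lemma : ∀ g x d → g ≡ - x * d + (g + x * d)
            lemma = solve-∀

  gcd-split : ∀ D E {z} → + gcd D E ∣ z → ∃₂ λ a b → (+ D ∣ a) × (+ E ∣ b) × (z ≡ a + b)
  gcd-split D E (divides γ refl) with gcd-combination D E
  ... | α , β , g≡ = γ * α * + D , γ * β * + E , divides (γ * α) refl , divides (γ * β) refl ,
    (begin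
      γ * + gcd D E             ≡⟨ cong (γ *_) g≡ ⟩
      γ * (α * + D + β * + E)   ≡⟨ lemma γ α β (+ D) (+ E) ⟩
      γ * α * + D + γ * β * + E ∎)
    where
    open ≡-Reasoning
    lemma : ∀ g a b d e → g * (a * d + b * e) ≡ g * a * d + g * b * e
    lemma = solve-∀


  module Cofactor (m : ℕ) where

    n : ℕ
    n = suc m

    divisor-pos : ∀ {d} → d ℕ.∣ n → 1 ≤ d
    divisor-pos {zero}  d∣n = ⊥-elim (ℕP.0≢1+n (sym (ℕ.0∣⇒≡0 d∣n)))
    divisor-pos {suc d} _   = s≤s z≤n

    cofactor-spec : ∀ {d} → d ℕ.∣ n → n ≡ divN n d ℕ.* d
    cofactor-spec {suc d} d∣n = sym (m/n*n≡m d∣n)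
    cofactor-spec {zero}  d∣n = ⊥-elim (ℕP.0≢1+n (sym (ℕ.0∣⇒≡0 d∣n)))

    cofactor-∣ : ∀ {d} → d ℕ.∣ n → divN n d ℕ.∣ n
    cofactor-∣ {d} d∣n = ℕ.divides d (trans (cofactor-spec d∣n) (ℕP.*-comm (divN n d) d))

    cofactor-pos : ∀ {d} → d ℕ.∣ n → 1 ≤ divN n d
    cofactor-pos d∣n = divisor-pos (cofactor-∣ d∣n)

    cofactor-involutive : ∀ {d} → d ℕ.∣ n → divN n (divN n d) ≡ d
    cofactor-involutive {d} d∣n = ℕP.*-cancelʳ-≡ (divN n e) d e {{ℕ.>-nonZero (cofactor-pos d∣n)}}
      (trans (sym (cofactor-spec (cofactor-∣ d∣n))) (trans (cofactor-spec d∣n) (ℕP.*-comm e d)))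
      where
      e : ℕ
      e = divN n d

    -- Writing w = n / lcm(r,s) and
    -- G = gcd(n/r, n/s) = n / M, we show w ∣ G (w divides both cofactors) and G ∣ w
    -- (r and s divide M, hence so does lcm(r,s)).
    cofactor-lcm : ∀ {r s} → r ℕ.∣ n → s ℕ.∣ n → divN n (lcm r s) ≡ gcd (divN n r) (divN n s)
    cofactor-lcm {r} {s} r∣n s∣n = ℕ.∣-antisym w∣G G∣w
      where
      L w G : ℕ
      L = lcm r s
      w = divN n L
      G = gcd (divN n r) (divN n s)
      L∣n : L ℕ.∣ n
      L∣n = lcm-least r∣n s∣n
      -- w ∣ n/d for every d ∣ L, since w * d divides w * L = n = (n/d) * d
      w∣cofactor : ∀ {d} → d ℕ.∣ n → d ℕ.∣ L → w ℕ.∣ divN n d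
      w∣cofactor {d} d∣n d∣L = ℕ.*-cancelʳ-∣ d {{ℕ.>-nonZero (divisor-pos d∣n)}}
        (subst (w ℕ.* d ℕ.∣_) (trans (sym (cofactor-spec L∣n)) (cofactor-spec d∣n)) (ℕ.*-monoʳ-∣ w d∣L))
      w∣G : w ℕ.∣ G
      w∣G = gcd-greatest (w∣cofactor r∣n (m∣lcm[m,n] r s)) (w∣cofactor s∣n (n∣lcm[m,n] r s))
      G∣n : G ℕ.∣ n
      G∣n = ℕ.∣-trans (gcd[m,n]∣m (divN n r) (divN n s)) (cofactor-∣ r∣n)
      M : ℕ
      M = ℕ.quotient G∣n
      n≡G*M : n ≡ G ℕ.* M
      n≡G*M = trans (ℕ._∣_.equality G∣n) (ℕP.*-comm M G)
      -- d ∣ M whenever G ∣ n/d, since G * d divides (n/d) * d = n = G * M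
      ∣M : ∀ {d} → d ℕ.∣ n → G ℕ.∣ divN n d → d ℕ.∣ M
      ∣M {d} d∣n G∣cof = ℕ.*-cancelˡ-∣ G {{ℕ.>-nonZero (divisor-pos G∣n)}}
        (subst (G ℕ.* d ℕ.∣_) (trans (sym (cofactor-spec d∣n)) n≡G*M) (ℕ.*-monoˡ-∣ d G∣cof))
      G∣w : G ℕ.∣ w
      G∣w = ℕ.*-cancelʳ-∣ L {{ℕ.>-nonZero (divisor-pos L∣n)}}
        (subst (G ℕ.* L ℕ.∣_) (trans (sym n≡G*M) (cofactor-spec L∣n))
          (ℕ.*-monoʳ-∣ G (lcm-least (∣M r∣n (gcd[m,n]∣m (divN n r) (divN n s)))
            (∣M s∣n (gcd[m,n]∣n (divN n r) (divN n s))))))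

  -- The sign twist x ↦ (-1)ᶠ x by which a reflection acts on rotations.
  twist : Bool → ℤ → ℤ
  twist false z = z
  twist true  z = - z

  -- ℤ/nℤ, represented by Fin n with the operations of Defs, compared with ℤ through ι.
  module Cyclic (m : ℕ) where

    n : ℕ
    n = suc m

    N : ℤ
    N = + n

    ι : Fin n → ℤ
    ι k = + toℕ k

    infix 4 _≈_
    _≈_ : ℤ → ℤ → Set
    a ≈ b = a ≡ b [mod N ]

    ι-mod : ∀ a → ι (a mod n) ≈ + a
    ι-mod a = ≡mod-trans (≡mod-reflexive (cong +_ (FinP.toℕ-fromℕ< (m%n<n a n))))
      (remainder-≡mod (+ (a / n)) N (trans (cong +_ (m≡m%n+[m/n]*n a n))
        (trans (ℤP.pos-+ (a % n) (a / n ℕ.* n)) (cong (λ w → + (a % n) + w) (ℤP.pos-* (a / n) n)))))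

    ι-exp : ∀ a → ι (expF m a) ≈ + a
    ι-exp = ι-mod

    ι-add : ∀ x y → ι (addF x y) ≈ ι x + ι y
    ι-add x y = ≡mod-trans (ι-mod (toℕ x ℕ.+ toℕ y)) (≡mod-reflexive (ℤP.pos-+ (toℕ x) (toℕ y)))

    ι-neg : ∀ x → ι (negF x) ≈ - ι x
    ι-neg x = ≡mod-trans (ι-mod (n ℕ.∸ toℕ x)) (≡mod-trans (≡mod-reflexive n∸x≡N-x)
                (≡mod-sym (remainder-≡mod (+ 1) N (lemma N (ι x)))))
      where
      n∸x≡N-x : + (n ℕ.∸ toℕ x) ≡ N - ι x
      n∸x≡N-x = trans (sym (ℤP.⊖-≥ (ℕP.<⇒≤ (FinP.toℕ<n x)))) (sym (ℤP.m-n≡m⊖n n (toℕ x)))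
      lemma : ∀ N x → N - x ≡ - x + + 1 * N
      lemma = solve-∀

    ι-mul : ∀ e k f l → ι (proj₂ (mul (e , k) (f , l))) ≈ twist f (ι k) + ι l
    ι-mul e k false l = ι-add k l
    ι-mul e k true  l = ≡mod-trans (ι-add (negF k) l) (+-≡mod (ι-neg k) ≡mod-refl)

    ι-injective : ∀ {x y} → ι x ≈ ι y → x ≡ y
    ι-injective {x} {y} x≈y = FinP.toℕ-injective (≡mod-small (FinP.toℕ<n x) (FinP.toℕ<n y) x≈y)

    rep : ℤ → Fin n
    rep z = fromℕ< (ℤ.n%ℕd<d z n)

    ι-rep : ∀ z → ι (rep z) ≈ z
    ι-rep z = ≡mod-trans (≡mod-reflexive (cong +_ (FinP.toℕ-fromℕ< (ℤ.n%ℕd<d z n))))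
                (remainder-≡mod (z ℤ./ℕ n) N (ℤ.a≡a%ℕn+[a/ℕn]*n z n))

    expF-+ : ∀ a b → addF (expF m a) (expF m b) ≡ expF m (a ℕ.+ b)
    expF-+ a b = ι-injective (≡mod-trans (ι-add (expF m a) (expF m b))
      (≡mod-trans (+-≡mod (ι-exp a) (ι-exp b))
        (≡mod-trans (≡mod-reflexive (sym (ℤP.pos-+ a b))) (≡mod-sym (ι-exp (a ℕ.+ b))))))

    expF-step : ∀ q D → addF (expF m (q ℕ.* D)) (expF m D) ≡ expF m (suc q ℕ.* D)
    expF-step q D = trans (expF-+ (q ℕ.* D) D) (cong (expF m) (ℕP.+-comm (q ℕ.* D) D))

    expF-toℕ : ∀ {a k} → toℕ k ≡ a → expF m a ≡ k
    expF-toℕ {a} {k} refl = ι-injective (ι-exp (toℕ k))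

    expF-n : expF m n ≡ Fin.zero
    expF-n = ι-injective (≡mod-trans (ι-exp n) (≡mod-sym (remainder-≡mod (+ 1) N (lemma N))))
      where lemma : ∀ N → N ≡ + 0 + + 1 * N
            lemma = solve-∀

  -- Membership in a subset of D_n, as a proposition.  (A record rather than T (mem S x),
  -- so that x and S can be inferred from it.)
  infix 4 _∈ₛ_
  record _∈ₛ_ {n : ℕ} (x : El n) (S : Sub n) : Set where
    constructor ∈ₛ⁺
    field ∈ₛ⁻ : T (mem S x)
  open _∈ₛ_ public

  mem-fromPred : {n : ℕ} (P : El n → Bool) (x : El n) → mem (fromPred P) x ≡ P x
  mem-fromPred P (false , k) = lookup∘tabulate (λ k → P (false , k)) k
  mem-fromPred P (true  , k) = lookup∘tabulate (λ k → P (true , k)) k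

  Sub-ext : {n : ℕ} {S S' : Sub n} → (∀ x → mem S x ≡ mem S' x) → S ≡ S'
  Sub-ext {S = u , v} {u' , v'} same = cong₂ _,_
    (trans (sym (tabulate∘lookup u)) (trans (tabulate-cong (λ k → same (false , k))) (tabulate∘lookup u')))
    (trans (sym (tabulate∘lookup v)) (trans (tabulate-cong (λ k → same (true , k))) (tabulate∘lookup v')))

  Sub-ext⇔ : {n : ℕ} {S S' : Sub n} → (∀ x → x ∈ₛ S → x ∈ₛ S') →
    (∀ x → x ∈ₛ S' → x ∈ₛ S) → S ≡ S'
  Sub-ext⇔ to from = Sub-ext (λ x → T-ext (λ t → ∈ₛ⁻ (to x (∈ₛ⁺ t)))
    (λ t → ∈ₛ⁻ (from x (∈ₛ⁺ t))))

  ∈-fromPred⁺ : {n : ℕ} {P : El n → Bool} {x : El n} → T (P x) → x ∈ₛ fromPred P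
  ∈-fromPred⁺ {P = P} {x} t = ∈ₛ⁺ (subst T (sym (mem-fromPred P x)) t)

  ∈-fromPred⁻ : {n : ℕ} {P : El n → Bool} {x : El n} → x ∈ₛ fromPred P → T (P x)
  ∈-fromPred⁻ {P = P} {x} (∈ₛ⁺ t) = subst T (mem-fromPred P x) t

  ∈-elems : {n : ℕ} (x : El n) → x ∈ elems n
  ∈-elems {n} (false , k) = ∈-++⁺ˡ (∈-map⁺ (false ,_) (∈-allFin k))
  ∈-elems {n} (true  , k) = ∈-++⁺ʳ (map (false ,_) (Data.List.allFin n)) (∈-map⁺ (true ,_) (∈-allFin k))

  module _ {n : ℕ} {p : El n → Bool} where

    all-elems⁻ : T (all p (elems n)) → ∀ x → T (p x)
    all-elems⁻ t x = T-all⁻ {xs = elems n} t (∈-elems x)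

    all-elems⁺ : (∀ x → T (p x)) → T (all p (elems n))
    all-elems⁺ f = T-all⁺ {xs = elems n} (λ {x} _ → f x)

    any-elems⁻ : T (any p (elems n)) → ∃ λ x → T (p x)
    any-elems⁻ t = let x , _ , px = T-any⁻ {xs = elems n} t in x , px

    any-elems⁺ : ∀ x → T (p x) → T (any p (elems n))
    any-elems⁺ x = T-any⁺ {xs = elems n} (∈-elems x)

  eqEl-refl : {n : ℕ} (x : El n) → T (eqEl x x)
  eqEl-refl (e , k) = T-∧⁺ ⌊ e BoolP.≟ e ⌋ (fromWitness refl) (fromWitness refl)

  eqEl-sound : {n : ℕ} {x y : El n} → T (eqEl x y) → x ≡ y
  eqEl-sound {x = e , k} {f , l} t = let e≡f , k≡l = T-∧⁻ ⌊ e BoolP.≟ f ⌋ t in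
    cong₂ _,_ (toWitness e≡f) (toWitness k≡l)

  eqSub-refl : {n : ℕ} (S : Sub n) → T (eqSub S S)
  eqSub-refl S = all-elems⁺ {p = λ x → ⌊ mem S x BoolP.≟ mem S x ⌋} (λ _ → fromWitness refl)

  eqSub-sound : {n : ℕ} {S S' : Sub n} → T (eqSub S S') → S ≡ S'
  eqSub-sound t = Sub-ext (λ x → toWitness (all-elems⁻ t x))

  record SubgroupLaws {m : ℕ} (S : Sub (suc m)) : Set where
    field
      one∈ : one ∈ₛ S
      inv∈ : ∀ {x} → x ∈ₛ S → inv x ∈ₛ S
      mul∈ : ∀ {x y} → x ∈ₛ S → y ∈ₛ S → mul x y ∈ₛ S

  module _ {m : ℕ} {S : Sub (suc m)} where

    inverse-closed : Bool
    inverse-closed = all (λ x → not (mem S x) ∨ mem S (inv x)) (elems (suc m))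

    subgroup-laws : T (isSubgroup S) → SubgroupLaws S
    subgroup-laws t with T-∧⁻ (mem S one) t
    ... | one∈ , closed with T-∧⁻ inverse-closed closed
    ...   | inv-closed , mul-closed = record
      { one∈ = ∈ₛ⁺ one∈
      ; inv∈ = λ {x} (∈ₛ⁺ x∈) → ∈ₛ⁺ (T-⇒⁻ (mem S x) (all-elems⁻ inv-closed x) x∈)
      ; mul∈ = λ {x} {y} (∈ₛ⁺ x∈) (∈ₛ⁺ y∈) →
          ∈ₛ⁺ (T-⇒⁻ (mem S x ∧ mem S y) (all-elems⁻ (all-elems⁻ mul-closed x) y)
            (T-∧⁺ (mem S x) x∈ y∈))
      }

    isSubgroup⁺ : SubgroupLaws S → T (isSubgroup S)
    isSubgroup⁺ laws = T-∧⁺ (mem S one) (∈ₛ⁻ one∈) (T-∧⁺ inverse-closed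
      (all-elems⁺ (λ x → T-⇒⁺ (mem S x) (λ t → ∈ₛ⁻ (inv∈ (∈ₛ⁺ {x = x} t)))))
      (all-elems⁺ (λ x → all-elems⁺ (λ y → T-⇒⁺ (mem S x ∧ mem S y)
        (λ t → let x∈ , y∈ = T-∧⁻ (mem S x) t in
          ∈ₛ⁻ (mul∈ (∈ₛ⁺ {x = x} x∈) (∈ₛ⁺ {x = y} y∈)))))))
      where open SubgroupLaws laws

  conj : {n : ℕ} → El n → El n → El n
  conj g h = mul (mul g h) (inv g)

  module _ {n : ℕ} {S : Sub n} where

    isNormal⁻ : T (isNormal S) → ∀ g {h} → h ∈ₛ S → conj g h ∈ₛ S
    isNormal⁻ t g {h} (∈ₛ⁺ h∈) = ∈ₛ⁺ (T-⇒⁻ (mem S h) (all-elems⁻ (all-elems⁻ t g) h) h∈)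

    isNormal⁺ : (∀ g {h} → h ∈ₛ S → conj g h ∈ₛ S) → T (isNormal S)
    isNormal⁺ closed = all-elems⁺ (λ g → all-elems⁺ (λ h → T-⇒⁺ (mem S h)
      (λ t → ∈ₛ⁻ (closed g (∈ₛ⁺ {x = h} t)))))

    isProper⁺ : ∀ x → ¬ x ∈ₛ S → T (isProper S)
    isProper⁺ x x∉ = T-not⁺ (λ t → x∉ (∈ₛ⁺ (all-elems⁻ t x)))

    isProper⁻ : T (isProper S) → ¬ (∀ x → x ∈ₛ S)
    isProper⁻ t all∈ = T-not⁻ t (all-elems⁺ (λ x → ∈ₛ⁻ (all∈ x)))

  record InProduct {n : ℕ} (A B : Sub n) (x : El n) : Set where
    constructor product
    field
      {left right} : El n
      left∈  : left ∈ₛ A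
      right∈ : right ∈ₛ B
      equals : mul left right ≡ x

  module _ {n : ℕ} where

    inProd⁺ : ∀ {A B : Sub n} {x} → InProduct A B x → T (inProd A B x)
    inProd⁺ {A} {B} {x} (product {h} {y} (∈ₛ⁺ h∈) (∈ₛ⁺ y∈) refl) =
      any-elems⁺ {p = λ h → any (λ y → mem A h ∧ mem B y ∧ eqEl (mul h y) x) (elems n)} h
        (any-elems⁺ {p = λ y → mem A h ∧ mem B y ∧ eqEl (mul h y) x} y
          (T-∧⁺ (mem A h) h∈ (T-∧⁺ (mem B y) y∈ (eqEl-refl x))))

    inProd⁻ : ∀ {A B : Sub n} {x} → T (inProd A B x) → InProduct A B x
    inProd⁻ {A} {B} {x} t
      with any-elems⁻ {p = λ h → any (λ y → mem A h ∧ mem B y ∧ eqEl (mul h y) x) (elems n)} t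
    ... | h , t' with any-elems⁻ {p = λ y → mem A h ∧ mem B y ∧ eqEl (mul h y) x} t'
    ...   | y , t'' = let h∈ , rest = T-∧⁻ (mem A h) t'' ; y∈ , eq = T-∧⁻ (mem B y) rest in
                    product {left = h} {y} (∈ₛ⁺ h∈) (∈ₛ⁺ y∈) (eqEl-sound eq)

    permutes⁺ : ∀ {A B : Sub n} → (∀ {x} → InProduct A B x → InProduct B A x) →
      (∀ {x} → InProduct B A x → InProduct A B x) →
      T (permutes A B)
    permutes⁺ {A} {B} to from = all-elems⁺ (λ x → fromWitness {a? = inProd A B x BoolP.≟ inProd B A x}
      (T-ext (λ t → inProd⁺ (to (inProd⁻ {A = A} {B} {x} t)))
        (λ t → inProd⁺ (from (inProd⁻ {A = B} {A} {x} t)))))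

    permutes⁻ : ∀ {A B : Sub n} → T (permutes A B) → ∀ {x} → InProduct A B x → InProduct B A x
    permutes⁻ {A} {B} t {x} p =
      inProd⁻ (subst T (toWitness (all-elems⁻ {p = λ x → ⌊ inProd A B x BoolP.≟ inProd B A x ⌋} t x))
        (inProd⁺ {A = A} {B} {x} p))

  _∈ₛ?_ : {n : ℕ} (x : El n) (S : Sub n) → Dec (x ∈ₛ S)
  x ∈ₛ? S = map′ ∈ₛ⁺ ∈ₛ⁻ (T? (mem S x))

  module Dihedral (m : ℕ) where

    open Cyclic m public

    module ≈-Reasoning = Relation.Binary.Reasoning.Setoid (≡mod-setoid {N})

    twist-≈ : ∀ f {a b} → a ≈ b → twist f a ≈ twist f b
    twist-≈ false a≈b = a≈b
    twist-≈ true  a≈b = neg-≡mod a≈b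

    ι-inv : ∀ e k → ι (proj₂ (inv (e , k))) ≈ twist (not e) (ι k)
    ι-inv false k = ι-neg k
    ι-inv true  k = ≡mod-refl

    inv-involutive : ∀ x → inv (inv x) ≡ x
    inv-involutive (false , k) = cong (false ,_) (ι-injective
      (≡mod-trans (ι-neg (negF k)) (≡mod-trans (neg-≡mod (ι-neg k))
        (≡mod-reflexive (ℤP.neg-involutive (ι k))))))
    inv-involutive (true  , k) = refl

    ι-conj : ∀ e t f k → ι (proj₂ (conj (e , t) (f , k))) ≈ twist e (twist f (ι t) + ι k) + twist (not e) (ι t)
    ι-conj false t f k = ≡mod-trans (ι-mul f (proj₂ (mul (false , t) (f , k))) false (negF t))
      (+-≡mod (ι-mul false t f k) (ι-neg t))
    ι-conj true  t f k = ≡mod-trans (ι-mul (not f) (proj₂ (mul (true , t) (f , k))) true t)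
      (+-≡mod (neg-≡mod (ι-mul true t f k)) ≡mod-refl)

    conj-rot-rot : ∀ t k → ι (proj₂ (conj (false , t) (false , k))) ≈ ι k
    conj-rot-rot t k = ≡mod-trans (ι-conj false t false k) (≡mod-reflexive (lemma (ι t) (ι k)))
      where lemma : ∀ t k → (t + k) + - t ≡ k
            lemma = solve-∀

    conj-rot-ref : ∀ t k → ι (proj₂ (conj (false , t) (true , k))) ≈ ι k - + 2 * ι t
    conj-rot-ref t k = ≡mod-trans (ι-conj false t true k) (≡mod-reflexive (lemma (ι t) (ι k)))
      where lemma : ∀ t k → (- t + k) + - t ≡ k - + 2 * t
            lemma = solve-∀

    conj-ref-rot : ∀ t k → ι (proj₂ (conj (true , t) (false , k))) ≈ - ι k
    conj-ref-rot t k = ≡mod-trans (ι-conj true t false k) (≡mod-reflexive (lemma (ι t) (ι k)))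
      where lemma : ∀ t k → - (t + k) + t ≡ - k
            lemma = solve-∀

    conj-ref-ref : ∀ t k → ι (proj₂ (conj (true , t) (true , k))) ≈ + 2 * ι t - ι k
    conj-ref-ref t k = ≡mod-trans (ι-conj true t true k) (≡mod-reflexive (lemma (ι t) (ι k)))
      where lemma : ∀ t k → - (- t + k) + t ≡ + 2 * t - k
            lemma = solve-∀

    rotation-subgroup-normal : ∀ {S} → SubgroupLaws S → (∀ k → ¬ (true , k) ∈ₛ S) → T (isNormal S)
    rotation-subgroup-normal {S} laws no-reflection = isNormal⁺ closed
      where
      open SubgroupLaws laws
      closed : ∀ g {h} → h ∈ₛ S → conj g h ∈ₛ S
      closed g           {true  , k} h∈ = ⊥-elim (no-reflection k h∈)
      closed (false , t) {false , k} h∈ =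
        subst (_∈ₛ S) (cong (false ,_) (ι-injective (≡mod-sym (conj-rot-rot t k)))) h∈
      closed (true  , t) {false , k} h∈ =
        subst (_∈ₛ S) (cong (false ,_) (ι-injective (≡mod-trans (ι-neg k) (≡mod-sym (conj-ref-rot t k)))))
          (inv∈ h∈)

    -- The subgroup ⟨a^D, b a^c⟩ (for D ∣ n): rotations aᵏ with D ∣ k and reflections
    -- b aᵏ with D ∣ k - c.
    InDih : ℕ → ℤ → El n → Set
    InDih D c (false , k) = + D ∣ ι k
    InDih D c (true  , k) = + D ∣ ι k - c

    inDih? : ∀ D c x → Dec (InDih D c x)
    inDih? D c (false , k) = + D ∣? ι k
    inDih? D c (true  , k) = + D ∣? ι k - c

    -- Dih is only ever used through Dih⁻ and Dih⁺; keeping it opaque lets Agda infer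
    -- D and c from a type x ∈ₛ Dih D c.
    opaque
      Dih : ℕ → ℤ → Sub n
      Dih D c = fromPred (λ x → ⌊ inDih? D c x ⌋)

      Dih⁻ : ∀ {D c x} → x ∈ₛ Dih D c → InDih D c x
      Dih⁻ {D} {c} {x} x∈ = toWitness (∈-fromPred⁻ {P = λ x → ⌊ inDih? D c x ⌋} x∈)

      Dih⁺ : ∀ {D c x} → InDih D c x → x ∈ₛ Dih D c
      Dih⁺ {D} {c} {x} p = ∈-fromPred⁺ {P = λ x → ⌊ inDih? D c x ⌋} (fromWitness p)

    module Divisor {D : ℕ} (D∣n : D ℕ.∣ n) where

      D∣N : + D ∣ N
      D∣N = ∣ᵤ⇒∣ D∣n

      ≈⇒≡modD : ∀ {a b} → a ≈ b → a ≡ b [mod + D ]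
      ≈⇒≡modD = ≡mod-weaken D∣N

      transport : ∀ {a b} → a ≈ b → + D ∣ a → + D ∣ b
      transport a≈b = ∣-resp-≡mod (≈⇒≡modD a≈b)

      transport-c : ∀ {a b} c → a ≈ b → + D ∣ a - c → + D ∣ b - c
      transport-c c a≈b = transport (+-≡mod a≈b ≡mod-refl)

      rep-rotation∈ : ∀ {c z} → + D ∣ z → (false , rep z) ∈ₛ Dih D c
      rep-rotation∈ {z = z} D∣z = Dih⁺ (transport (≡mod-sym (ι-rep z)) D∣z)

      rep-reflection∈ : ∀ {c z} → + D ∣ z - c → (true , rep z) ∈ₛ Dih D c
      rep-reflection∈ {c} {z} D∣z-c = Dih⁺ (transport-c c (≡mod-sym (ι-rep z)) D∣z-c)

      Dih-subgroup : ∀ c → SubgroupLaws (Dih D c)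
      Dih-subgroup c = record
        { one∈ = Dih⁺ {c = c} ∣-zero
        ; inv∈ = λ {x} x∈ → Dih⁺ (inv-closed x (Dih⁻ x∈))
        ; mul∈ = λ {x} {y} x∈ y∈ → Dih⁺ (mul-closed x y (Dih⁻ x∈) (Dih⁻ y∈))
        }
        where
        inv-closed : ∀ x → InDih D c x → InDih D c (inv x)
        inv-closed (false , k) p = transport (≡mod-sym (ι-neg k)) (∣m⇒∣-m p)
        inv-closed (true  , k) p = p
        mul-closed : ∀ x y → InDih D c x → InDih D c y → InDih D c (mul x y)
        mul-closed (false , k) (false , l) p q =
          transport (≡mod-sym (ι-mul false k false l)) (∣m∣n⇒∣m+n p q)
        mul-closed (true , k) (false , l) p q =
          transport-c c (≡mod-sym (ι-mul true k false l))
            (subst (+ D ∣_) (lemma (ι k) (ι l) c) (∣m∣n⇒∣m+n p q))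
          where lemma : ∀ a b c → (a - c) + b ≡ (a + b) - c
                lemma = solve-∀
        mul-closed (false , k) (true , l) p q =
          transport-c c (≡mod-sym (ι-mul false k true l))
            (subst (+ D ∣_) (lemma (ι k) (ι l) c) (∣m∣n⇒∣m+n (∣m⇒∣-m p) q))
          where lemma : ∀ a b c → - a + (b - c) ≡ (- a + b) - c
                lemma = solve-∀
        mul-closed (true , k) (true , l) p q =
          transport (≡mod-sym (ι-mul true k true l))
            (subst (+ D ∣_) (lemma (ι k) (ι l) c) (∣m∣n⇒∣m+n (∣m⇒∣-m p) q))
          where lemma : ∀ a b c → - (a - c) + (b - c) ≡ - a + b
                lemma = solve-∀

      -- ⟨a^D, b a^c⟩ is proper when D ≥ 2: it misses a.
      Dih-proper : ∀ c → 2 ≤ D → T (isProper (Dih D c))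
      Dih-proper c 2≤D =
        isProper⁺ (false , expF m 1) (λ a∈ → ℕP.<⇒≱ 2≤D (ℕ.∣⇒≤ (∣⇒∣ᵤ (D∣1 a∈))))
        where
        D∣1 : (false , expF m 1) ∈ₛ Dih D c → + D ∣ + 1
        D∣1 a∈ = transport (ι-exp 1) (Dih⁻ a∈)

      -- ⟨a^D, b a^c⟩ is normal iff D ∣ 2: conjugating b a^k by a^t gives b a^(k - 2t).
      Dih-normal : ∀ c → + D ∣ + 2 → T (isNormal (Dih D c))
      Dih-normal c D∣2 = isNormal⁺ (λ g h∈ → Dih⁺ (closed g _ (Dih⁻ h∈)))
        where
        closed : ∀ g h → InDih D c h → InDih D c (conj g h)
        closed (false , t) (false , k) p = transport (≡mod-sym (conj-rot-rot t k)) p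
        closed (true  , t) (false , k) p = transport (≡mod-sym (conj-ref-rot t k)) (∣m⇒∣-m p)
        closed (false , t) (true  , k) p = transport-c c (≡mod-sym (conj-rot-ref t k))
          (subst (+ D ∣_) (lemma (ι t) (ι k) c) (∣m∣n⇒∣m+n p (∣n⇒∣m*n (- ι t) D∣2)))
          where lemma : ∀ t k c → (k - c) + - t * + 2 ≡ (k - + 2 * t) - c
                lemma = solve-∀
        closed (true  , t) (true  , k) p = transport-c c (≡mod-sym (conj-ref-ref t k))
          (subst (+ D ∣_) (lemma (ι t) (ι k) c) (∣m∣n⇒∣m+n (∣m⇒∣-m p) (∣n⇒∣m*n (ι t - c) D∣2)))
          where lemma : ∀ t k c → - (k - c) + (t - c) * + 2 ≡ (+ 2 * t - k) - c
                lemma = solve-∀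

      Dih-not-normal : ∀ c → ¬ (+ D ∣ + 2) → ¬ T (isNormal (Dih D c))
      Dih-not-normal c D∤2 normal = D∤2 (subst (+ D ∣_) (ℤP.neg-involutive (+ 2)) (∣m⇒∣-m D∣-2))
        where
        a r : Fin n
        a = expF m 1
        r = rep c
        reflection∈ : (true , r) ∈ₛ Dih D c
        reflection∈ = rep-reflection∈ {c} {c} (∣-self-difference c)
        -- a (b aʳ) a⁻¹ = b a^(r - 2) lies in the subgroup as well, so D ∣ (r - 2) - r
        conjugate∈ : conj (false , a) (true , r) ∈ₛ Dih D c
        conjugate∈ = isNormal⁻ normal (false , a) reflection∈
        difference : (ι (proj₂ (conj (false , a) (true , r))) - c) - (ι r - c) ≈ - + 2
        difference = begin
          (ι (proj₂ (conj (false , a) (true , r))) - c) - (ι r - c)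
            ≈⟨ +-≡mod (+-≡mod (conj-rot-ref a r) ≡mod-refl) ≡mod-refl ⟩
          ((ι r - + 2 * ι a) - c) - (ι r - c)                       ≡⟨ lemma (ι r) (ι a) c ⟩
          - (+ 2 * ι a)                                             ≈⟨ neg-≡mod (*-≡mod (+ 2) (ι-exp 1)) ⟩
          - (+ 2 * + 1)                                             ∎
          where
          open ≈-Reasoning
          lemma : ∀ r a c → ((r - + 2 * a) - c) - (r - c) ≡ - (+ 2 * a)
          lemma = solve-∀
        D∣-2 : + D ∣ - + 2
        D∣-2 = transport difference (∣m∣n⇒∣m-n (Dih⁻ conjugate∈) (Dih⁻ reflection∈))

    Dih-whole : ∀ c x → x ∈ₛ Dih 1 c
    Dih-whole c (false , k) = Dih⁺ (∣ᵤ⇒∣ (ℕ.1∣ _))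
    Dih-whole c (true  , k) = Dih⁺ (∣ᵤ⇒∣ (ℕ.1∣ _))

    -- A proper, non-normal ⟨a^D, b a^c⟩ has D ≥ 3: D = 1 gives the whole group, D = 2 a normal subgroup.
    Dih-index-≥3 : ∀ {D c} → D ℕ.∣ n → T (isProper (Dih D c)) → ¬ T (isNormal (Dih D c)) → 3 ≤ D
    Dih-index-≥3 {zero}              0∣n _      _          = ⊥-elim (ℕP.0≢1+n (sym (ℕ.0∣⇒≡0 0∣n)))
    Dih-index-≥3 {suc zero}    {c}   _   proper _          = ⊥-elim (isProper⁻ proper (Dih-whole c))
    Dih-index-≥3 {suc (suc zero)} {c} 2∣n _     non-normal = ⊥-elim (non-normal (Divisor.Dih-normal 2∣n c ∣-refl))
    Dih-index-≥3 {suc (suc (suc _))} _   _      _          = s≤s (s≤s (s≤s z≤n))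

    Dih-shift : ∀ {D c c'} → + D ∣ c - c' → Dih D c ≡ Dih D c'
    Dih-shift {D} {c} {c'} D∣c-c' = Sub-ext⇔ (λ x x∈ → Dih⁺ (to x (Dih⁻ x∈)))
      (λ x x∈ → Dih⁺ (from x (Dih⁻ x∈)))
      where
      to : ∀ x → InDih D c x → InDih D c' x
      to (false , k) p = p
      to (true  , k) p = subst (+ D ∣_) (lemma (ι k) c c') (∣m∣n⇒∣m+n p D∣c-c')
        where lemma : ∀ k c c' → (k - c) + (c - c') ≡ k - c'
              lemma = solve-∀
      from : ∀ x → InDih D c' x → InDih D c x
      from (false , k) p = p
      from (true  , k) p = subst (+ D ∣_) (lemma (ι k) c c') (∣m∣n⇒∣m-n p D∣c-c')
        where lemma : ∀ k c c' → (k - c') - (c - c') ≡ k - c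
              lemma = solve-∀

    Dih-injective : ∀ {D D' c c'} → D ℕ.∣ n → D' ℕ.∣ n → Dih D c ≡ Dih D' c' → D ≡ D' × + D ∣ c - c'
    Dih-injective {D} {D'} {c} {c'} D∣n D'∣n same = D≡D' , D∣c-c'
      where
      module OnD = Divisor D∣n
      -- a^D lies in Dih D' c', so D' ∣ D, and symmetrically
      divides-other : ∀ {D D' c c'} → D ℕ.∣ n → D' ℕ.∣ n → Dih D c ≡ Dih D' c' → D' ℕ.∣ D
      divides-other {D} {D'} {c} {c'} D∣n D'∣n same =
        ∣⇒∣ᵤ (Divisor.transport D'∣n (ι-exp D) (Dih⁻ (subst ((false , expF m D) ∈ₛ_) same aᴰ∈)))
        where
        aᴰ∈ : (false , expF m D) ∈ₛ Dih D c
        aᴰ∈ = Dih⁺ (Divisor.transport D∣n (≡mod-sym (ι-exp D)) ∣-refl)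
      D≡D' : D ≡ D'
      D≡D' = ℕ.∣-antisym (divides-other D'∣n D∣n (sym same)) (divides-other D∣n D'∣n same)
      -- b a^c lies in Dih D c' as well
      D∣c-c' : + D ∣ c - c'
      D∣c-c' = OnD.transport-c c' (ι-rep c)
        (Dih⁻ (subst ((true , rep c) ∈ₛ_) (trans same (cong (λ E → Dih E c') (sym D≡D')))
          (OnD.rep-reflection∈ {c} {c} (∣-self-difference c))))

  module Generation (m : ℕ) where

    open Dihedral m
    open Cofactor m using (divisor-pos)

    Product : Sub n → El n → El n → Bool
    Product S x y = any (λ z → mem S y ∧ mem S z ∧ eqEl (mul y z) x) (elems n)

    Step : Sub n → El n → Bool
    Step S x = mem S x ∨ mem S (inv x) ∨ any (Product S x) (elems n)

    closeStep-⊇ : ∀ {S x} → x ∈ₛ S → x ∈ₛ closeStep S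
    closeStep-⊇ {S} {x} (∈ₛ⁺ x∈) = ∈-fromPred⁺ {P = Step S} (T-∨⁺ˡ (mem S x) x∈)

    closeStep-mul : ∀ {S y z} → y ∈ₛ S → z ∈ₛ S → mul y z ∈ₛ closeStep S
    closeStep-mul {S} {y} {z} (∈ₛ⁺ y∈) (∈ₛ⁺ z∈) =
      ∈-fromPred⁺ {P = Step S} (T-∨⁺ʳ (mem S (mul y z)) (T-∨⁺ʳ (mem S (inv (mul y z))) product∈))
      where
      product∈ : T (any (Product S (mul y z)) (elems n))
      product∈ = any-elems⁺ y (any-elems⁺ z (T-∧⁺ (mem S y) y∈ (T-∧⁺ (mem S z) z∈ (eqEl-refl (mul y z)))))

    closeStep-least : (P : El n → Set) → (∀ x → P x → P (inv x)) → (∀ x y → P x → P y → P (mul x y)) →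
      ∀ {S} → (∀ x → x ∈ₛ S → P x) → ∀ x → x ∈ₛ closeStep S → P x
    closeStep-least P P-inv P-mul {S} P-S x x∈ with T-∨⁻ (mem S x) (∈-fromPred⁻ {P = Step S} x∈)
    ... | inj₁ x∈S = P-S x (∈ₛ⁺ x∈S)
    ... | inj₂ rest with T-∨⁻ (mem S (inv x)) rest
    ...   | inj₁ x⁻¹∈S = subst P (inv-involutive x) (P-inv (inv x) (P-S (inv x) (∈ₛ⁺ x⁻¹∈S)))
    ...   | inj₂ product∈ with any-elems⁻ {p = Product S x} product∈
    ...     | y , product∈' with any-elems⁻ {p = λ z → mem S y ∧ mem S z ∧ eqEl (mul y z) x} product∈'
    ...       | z , t = let y∈ , rest' = T-∧⁻ (mem S y) t ; z∈ , eq = T-∧⁻ (mem S z) rest' in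
                        subst P (eqEl-sound eq) (P-mul y z (P-S y (∈ₛ⁺ y∈)) (P-S z (∈ₛ⁺ z∈)))

    Seed : List (El n) → El n → Bool
    Seed gs x = eqEl x one ∨ any (eqEl x) gs

    stage : List (El n) → ℕ → Sub n
    stage gs t = iter t closeStep (fromPred (Seed gs))

    stage-mono : ∀ gs {t t' x} → t ≤ t' → x ∈ₛ stage gs t → x ∈ₛ stage gs t'
    stage-mono gs {t} {t'} {x} t≤t' x∈ = subst (λ u → x ∈ₛ stage gs u) (ℕP.m∸n+n≡m t≤t')
      (later (t' ℕ.∸ t) x∈)
      where
      later : ∀ k → x ∈ₛ stage gs t → x ∈ₛ stage gs (k ℕ.+ t)
      later zero    x∈ = x∈
      later (suc k) x∈ = closeStep-⊇ (later k x∈)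

    one∈stage : ∀ gs t → one ∈ₛ stage gs t
    one∈stage gs t = stage-mono gs {t = 0} {t} z≤n
      (∈-fromPred⁺ {P = Seed gs} (T-∨⁺ˡ (eqEl (one {m}) one) {any (eqEl (one {m})) gs} (eqEl-refl (one {m}))))

    generator∈stage : ∀ {gs g} t → g ∈ gs → g ∈ₛ stage gs t
    generator∈stage {gs} {g} t g∈ =
      stage-mono gs {t = 0} {t} z≤n (∈-fromPred⁺ {P = Seed gs} (T-∨⁺ʳ (eqEl g one) (T-any⁺ g∈ (eqEl-refl g))))

    generated-⊆ : ∀ {S} gs → SubgroupLaws S → (∀ {g} → g ∈ gs → g ∈ₛ S) →
      ∀ x → x ∈ₛ generated gs → x ∈ₛ S
    generated-⊆ {S} gs laws gs⊆S = within (2 ℕ.* n)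
      where
      open SubgroupLaws laws
      within : ∀ t x → x ∈ₛ stage gs t → x ∈ₛ S
      within zero    x x∈ with T-∨⁻ (eqEl x one) (∈-fromPred⁻ {P = Seed gs} x∈)
      ... | inj₁ x≡1 = subst (_∈ₛ S) (sym (eqEl-sound x≡1)) one∈
      ... | inj₂ x∈gs = let g , g∈ , x≡g = T-any⁻ {xs = gs} x∈gs in
        subst (_∈ₛ S) (sym (eqEl-sound x≡g)) (gs⊆S g∈)
      within (suc t) = closeStep-least (_∈ₛ S) (λ _ → inv∈) (λ _ _ → mul∈) (within t)

    -- For D ∣ n and c ≤ n, the subgroup generated by a^D and b a^c is Dih D c: the stage
    -- q contains a^(qD), and every element of Dih D c is a^(qD) or b a^c · a^(qD) with q < 2n.
    module _ {D : ℕ} (D∣n : D ℕ.∣ n) (c : ℕ) (c≤n : c ≤ n) where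

      open Divisor D∣n

      gens : List (El n)
      gens = (false , expF m D) ∷ (true , expF m c) ∷ []

      rotations∈ : ∀ q → (false , expF m (q ℕ.* D)) ∈ₛ stage gens q
      rotations∈ zero    = one∈stage gens 0
      rotations∈ (suc q) = subst (_∈ₛ stage gens (suc q)) (cong (false ,_) (expF-step q D))
        (closeStep-mul {stage gens q} (rotations∈ q) (generator∈stage {gens} q (here refl)))

      q<2n : ∀ {q W} → W ≡ q ℕ.* D → W < n ℕ.+ n → q < 2 ℕ.* n
      q<2n {q} refl W<2n = ℕP.≤-<-trans (ℕP.m≤m*n q D {{ℕ.>-nonZero (divisor-pos D∣n)}})
        (subst (q ℕ.* D <_) (cong (n ℕ.+_) (sym (ℕP.+-identityʳ n))) W<2n)

      -- k + (n - c) is a natural number representing k - c modulo n.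
      shifted-value : ∀ k → + (toℕ k ℕ.+ (n ℕ.∸ c)) ≡ (ι k - + c) + N
      shifted-value k = trans (ℤP.pos-+ (toℕ k) (n ℕ.∸ c))
        (trans (cong (λ w → ι k + w) (trans (sym (ℤP.⊖-≥ c≤n)) (sym (ℤP.m-n≡m⊖n n c))))
          (lemma (ι k) (+ c) N))
        where lemma : ∀ k c N → k + (N - c) ≡ (k - c) + N
              lemma = solve-∀

      Dih⊆generated : ∀ x → InDih D (+ c) x → x ∈ₛ generated gens
      Dih⊆generated (false , k) D∣k with ∣⇒∣ᵤ D∣k
      ... | ℕ.divides q k≡qD = stage-mono gens {q} (ℕP.<⇒≤
        (q<2n k≡qD (ℕP.<-≤-trans (FinP.toℕ<n k) (ℕP.m≤m+n n n))))
        (subst (_∈ₛ stage gens q) (cong (false ,_) (expF-toℕ k≡qD)) (rotations∈ q))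
      Dih⊆generated (true , k) D∣k-c
        with ∣⇒∣ᵤ (subst (+ D ∣_) (sym (shifted-value k)) (∣m∣n⇒∣m+n D∣k-c D∣N))
      ... | ℕ.divides q W≡qD = stage-mono gens {suc q}
        (q<2n W≡qD (ℕP.+-mono-<-≤ (FinP.toℕ<n k) (ℕP.m∸n≤m n c)))
        (subst (_∈ₛ stage gens (suc q)) (cong (true ,_) (ι-injective value))
          (closeStep-mul {stage gens q} (generator∈stage {gens} q (there (here refl))) (rotations∈ q)))
        where
        open ≈-Reasoning
        value : ι (addF (expF m c) (expF m (q ℕ.* D))) ≈ ι k
        value = begin
          ι (addF (expF m c) (expF m (q ℕ.* D))) ≈⟨ ι-add (expF m c) (expF m (q ℕ.* D)) ⟩
          ι (expF m c) + ι (expF m (q ℕ.* D))    ≈⟨ +-≡mod (ι-exp c) (ι-exp (q ℕ.* D)) ⟩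
          + c + + (q ℕ.* D)                      ≡⟨ cong (λ w → + c + + w) (sym W≡qD) ⟩
          + c + + (toℕ k ℕ.+ (n ℕ.∸ c))         ≡⟨ cong (λ w → + c + w) (shifted-value k) ⟩
          + c + ((ι k - + c) + N)                ≡⟨ lemma (ι k) (+ c) N ⟩
          ι k + + 1 * N                          ≈⟨ +-multiple-≡mod (ι k) (+ 1) ⟩
          ι k                                    ∎
          where lemma : ∀ k c N → c + ((k - c) + N) ≡ k + + 1 * N
                lemma = solve-∀

      generated-Dih : generated gens ≡ Dih D (+ c)
      generated-Dih = Sub-ext⇔ (generated-⊆ gens (Dih-subgroup (+ c)) gens⊆Dih)
        (λ x x∈ → Dih⊆generated x (Dih⁻ x∈))
        where
        gens⊆Dih : ∀ {g} → g ∈ gens → g ∈ₛ Dih D (+ c)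
        gens⊆Dih (here refl)         = Dih⁺ (transport (≡mod-sym (ι-exp D)) ∣-refl)
        gens⊆Dih (there (here refl)) = Dih⁺ (transport-c (+ c) (≡mod-sym (ι-exp c))
                                         (∣-self-difference (+ c)))

  -- Subgroups containing a reflection b a^k₀ are exactly the Dih D k₀ with D ∣ n; D is the
  -- least positive exponent with a^D in the subgroup.
  module Classification (m : ℕ) where

    open Dihedral m

    module WithReflection {S : Sub n} (laws : SubgroupLaws S) {k₀ : Fin n} (reflection∈ : (true , k₀) ∈ₛ S) where

      open SubgroupLaws laws

      rot : ℕ → El n
      rot a = (false , expF m a)

      aⁿ∈ : rot n ∈ₛ S
      aⁿ∈ = subst (_∈ₛ S) (cong (false ,_) (sym expF-n)) one∈

      least : ∃ λ t → rot (suc t) ∈ₛ S × (∀ {u} → u < t → ¬ rot (suc u) ∈ₛ S)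
      least = least-witness (λ u → rot (suc u) ∈ₛ? S) m aⁿ∈

      D : ℕ
      D = suc (proj₁ least)

      aᴰ∈ : rot D ∈ₛ S
      aᴰ∈ = proj₁ (proj₂ least)

      multiples∈ : ∀ q → rot (q ℕ.* D) ∈ₛ S
      multiples∈ zero    = one∈
      multiples∈ (suc q) = subst (_∈ₛ S) (cong (false ,_) (expF-step q D)) (mul∈ (multiples∈ q) aᴰ∈)

      -- If aᵃ ∈ S then D ∣ a: a^(a mod D) = aᵃ (a^(qD))⁻¹ ∈ S, so a mod D = 0 by minimality.
      exponent-divisible : ∀ a → rot a ∈ₛ S → D ℕ.∣ a
      exponent-divisible a aᵃ∈ = ℕ.m%n≡0⇒n∣m a D (remainder-zero (a % D) refl)
        where
        q qD : ℕ
        q = a / D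
        qD = q ℕ.* D
        remainder∈ : rot (a % D) ∈ₛ S
        remainder∈ = subst (_∈ₛ S) (cong (false ,_) (ι-injective value)) (mul∈ aᵃ∈ (inv∈ (multiples∈ q)))
          where
          open ≈-Reasoning
          value : ι (addF (expF m a) (negF (expF m qD))) ≈ ι (expF m (a % D))
          value = begin
            ι (addF (expF m a) (negF (expF m qD))) ≈⟨ ι-mul false (expF m a) false (negF (expF m qD)) ⟩
            ι (expF m a) + ι (negF (expF m qD))
              ≈⟨ +-≡mod (ι-exp a) (≡mod-trans (ι-neg (expF m qD)) (neg-≡mod (ι-exp qD))) ⟩
            + a - + qD                             ≡⟨ cong (λ w → + w - + qD) (m≡m%n+[m/n]*n a D) ⟩
            + (a % D ℕ.+ qD) - + qD                ≡⟨ cong (_- + qD) (ℤP.pos-+ (a % D) qD) ⟩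
            + (a % D) + + qD - + qD                ≡⟨ lemma (+ (a % D)) (+ qD) ⟩
            + (a % D)                              ≈⟨ ≡mod-sym (ι-exp (a % D)) ⟩
            ι (expF m (a % D))                     ∎
            where lemma : ∀ r s → r + s - s ≡ r
                  lemma = solve-∀
        remainder-zero : ∀ r → a % D ≡ r → r ≡ 0
        remainder-zero zero    _  = refl
        remainder-zero (suc u) eq = ⊥-elim (proj₂ (proj₂ least) (ℕP.≤-pred (subst (ℕ._< D) eq (m%n<n a D)))
                                      (subst (λ w → rot w ∈ₛ S) eq remainder∈))

      D∣n : D ℕ.∣ n
      D∣n = exponent-divisible n aⁿ∈

      open Divisor D∣n

      rotation⇒ : ∀ k → (false , k) ∈ₛ S → + D ∣ ι k
      rotation⇒ k k∈ =
        ∣ᵤ⇒∣ (exponent-divisible (toℕ k) (subst (_∈ₛ S) (cong (false ,_) (sym (expF-toℕ refl))) k∈))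

      rotation⇐ : ∀ k → + D ∣ ι k → (false , k) ∈ₛ S
      rotation⇐ k D∣k with ∣⇒∣ᵤ D∣k
      ... | ℕ.divides q k≡qD = subst (_∈ₛ S) (cong (false ,_) (expF-toℕ k≡qD)) (multiples∈ q)

      -- (b a^k₀)(b aᵏ) = a^(k - k₀): reflections in S are the b aᵏ with D ∣ k - k₀.
      reflection⇒ : ∀ k → (true , k) ∈ₛ S → + D ∣ ι k - ι k₀
      reflection⇒ k k∈ = transport value (rotation⇒ _ (mul∈ reflection∈ k∈))
        where
        value : ι (addF (negF k₀) k) ≈ ι k - ι k₀
        value = ≡mod-trans (ι-mul true k₀ true k) (≡mod-reflexive (ℤP.+-comm (- ι k₀) (ι k)))

      reflection⇐ : ∀ k → + D ∣ ι k - ι k₀ → (true , k) ∈ₛ S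
      reflection⇐ k D∣k-k₀ = subst (_∈ₛ S) (cong (true ,_) (ι-injective value))
        (mul∈ reflection∈ (rotation⇐ ρ D∣ρ))
        where
        ρ : Fin n
        ρ = rep (ι k - ι k₀)
        D∣ρ : + D ∣ ι ρ
        D∣ρ = transport (≡mod-sym (ι-rep (ι k - ι k₀))) D∣k-k₀
        value : ι (addF k₀ ρ) ≈ ι k
        value = ≡mod-trans (ι-mul true k₀ false ρ)
          (≡mod-trans (+-≡mod (≡mod-refl {a = ι k₀}) (ι-rep (ι k - ι k₀)))
                  (≡mod-reflexive (lemma (ι k₀) (ι k))))
          where lemma : ∀ k₀ k → k₀ + (k - k₀) ≡ k
                lemma = solve-∀

      classification : S ≡ Dih D (ι k₀)
      classification = Sub-ext⇔ (λ x x∈ → Dih⁺ (to x x∈)) (λ x x∈ → from x (Dih⁻ x∈))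
        where
        to : ∀ x → x ∈ₛ S → InDih D (ι k₀) x
        to (false , k) = rotation⇒ k
        to (true  , k) = reflection⇒ k
        from : ∀ x → InDih D (ι k₀) x → x ∈ₛ S
        from (false , k) = rotation⇐ k
        from (true  , k) = reflection⇐ k

    dihedral-form : ∀ {S} → SubgroupLaws S → ∀ {k₀} → (true , k₀) ∈ₛ S →
      ∃₂ λ D c₀ → D ℕ.∣ n × c₀ < D × S ≡ Dih D (+ c₀)
    dihedral-form laws {k₀} k₀∈ = D , c₀ , D∣n , m%n<n (toℕ k₀) D ,
      trans classification (Dih-shift D∣k₀-c₀)
      where
      open WithReflection laws k₀∈
      c₀ : ℕ
      c₀ = toℕ k₀ % D
      k₀≡ : ι k₀ ≡ + c₀ + + (toℕ k₀ / D) * + D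
      k₀≡ = trans (cong +_ (m≡m%n+[m/n]*n (toℕ k₀) D))
              (trans (ℤP.pos-+ c₀ _) (cong (λ w → + c₀ + w) (ℤP.pos-* (toℕ k₀ / D) D)))
      D∣k₀-c₀ : + D ∣ ι k₀ - + c₀
      D∣k₀-c₀ = divides-difference (≡mod-sym (remainder-≡mod {r = + c₀} (+ (toℕ k₀ / D)) (+ D) k₀≡))

  module Products (m : ℕ) where

    open Dihedral m

    -- The product set, described through a common divisor g of D and E that is an
    -- integer combination of them (g = gcd D E).
    module Product {D E g : ℕ} (D∣n : D ℕ.∣ n) (E∣n : E ℕ.∣ n) (g∣D : + g ∣ + D) (g∣E : + g ∣ + E)
      (split : ∀ {z} → + g ∣ z → ∃₂ λ a b → (+ D ∣ a) × (+ E ∣ b) × (z ≡ a + b)) (c c' : ℤ) where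

      module OnD = Divisor D∣n
      module OnE = Divisor E∣n
      open Divisor (ℕ.∣-trans (∣⇒∣ᵤ g∣D) D∣n) using (transport)

      A B : Sub n
      A = Dih D c
      B = Dih E c'

      InAB : El n → Set
      InAB (false , k) = (+ g ∣ ι k) ⊎ (+ g ∣ ι k - (c' - c))
      InAB (true  , k) = (+ g ∣ ι k - c) ⊎ (+ g ∣ ι k - c')

      product⇒ : ∀ {x} → InProduct A B x → InAB x
      product⇒ (product h∈ y∈ refl) = go _ _ (Dih⁻ h∈) (Dih⁻ y∈)
        where
        go : ∀ h y → InDih D c h → InDih E c' y → InAB (mul h y)
        go (false , u) (false , v) p q =
          inj₁ (transport (≡mod-sym (ι-mul false u false v))
            (∣m∣n⇒∣m+n (∣-trans g∣D p) (∣-trans g∣E q)))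
        go (false , u) (true  , v) p q =
          inj₂ (transport (+-≡mod (≡mod-sym (ι-mul false u true v)) (≡mod-refl {a = - c'}))
            (subst (+ g ∣_) (lemma (ι u) (ι v) c')
              (∣m∣n⇒∣m+n (∣m⇒∣-m (∣-trans g∣D p)) (∣-trans g∣E q))))
          where lemma : ∀ u v c' → - u + (v - c') ≡ (- u + v) - c'
                lemma = solve-∀
        go (true  , u) (false , v) p q =
          inj₁ (transport (+-≡mod (≡mod-sym (ι-mul true u false v)) (≡mod-refl {a = - c}))
            (subst (+ g ∣_) (lemma (ι u) (ι v) c) (∣m∣n⇒∣m+n (∣-trans g∣D p) (∣-trans g∣E q))))
          where lemma : ∀ u v c → (u - c) + v ≡ (u + v) - c
                lemma = solve-∀
        go (true  , u) (true  , v) p q =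
          inj₂ (transport (+-≡mod (≡mod-sym (ι-mul true u true v)) (≡mod-refl {a = - (c' - c)}))
            (subst (+ g ∣_) (lemma (ι u) (ι v) c c')
              (∣m∣n⇒∣m+n (∣m⇒∣-m (∣-trans g∣D p)) (∣-trans g∣E q))))
          where lemma : ∀ u v c c' → - (u - c) + (v - c') ≡ (- u + v) - (c' - c)
                lemma = solve-∀

      product-of : ∀ e f {k} u v → (e , rep u) ∈ₛ A → (f , rep v) ∈ₛ B → twist f u + v ≈ ι k →
        InProduct A B (e xor f , k)
      product-of e f u v h∈ y∈ value = product h∈ y∈ (cong (e xor f ,_) (ι-injective
        (≡mod-trans (ι-mul e (rep u) f (rep v)) (≡mod-trans (+-≡mod (twist-≈ f (ι-rep u)) (ι-rep v)) value))))

      product⇐ : ∀ {x} → InAB x → InProduct A B x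
      product⇐ {false , k} (inj₁ g∣k) with split g∣k
      ... | a , b , D∣a , E∣b , k≡ =
        product-of false false a b (OnD.rep-rotation∈ D∣a) (OnE.rep-rotation∈ E∣b) (≡mod-reflexive (sym k≡))
      product⇐ {false , k} (inj₂ g∣k-δ) with split g∣k-δ
      ... | a , b , D∣a , E∣b , k≡ =
        product-of true true (c - a) (c' + b)
          (OnD.rep-reflection∈ {z = c - a} (subst (+ D ∣_) (lemma₁ c a) (∣m⇒∣-m D∣a)))
          (OnE.rep-reflection∈ {z = c' + b} (subst (+ E ∣_) (lemma₂ c' b) E∣b))
          (≡mod-reflexive (trans (lemma₃ a b c c') (trans (cong (_+ (c' - c)) (sym k≡)) (lemma₄ (ι k) (c' - c)))))
        where
        lemma₁ : ∀ c a → - a ≡ (c - a) - c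
        lemma₁ = solve-∀
        lemma₂ : ∀ c' b → b ≡ (c' + b) - c'
        lemma₂ = solve-∀
        lemma₃ : ∀ a b c c' → - (c - a) + (c' + b) ≡ (a + b) + (c' - c)
        lemma₃ = solve-∀
        lemma₄ : ∀ k δ → (k - δ) + δ ≡ k
        lemma₄ = solve-∀
      product⇐ {true , k} (inj₁ g∣k-c) with split g∣k-c
      ... | a , b , D∣a , E∣b , k≡ =
        product-of true false (c + a) b
          (OnD.rep-reflection∈ {z = c + a} (subst (+ D ∣_) (lemma₁ c a) D∣a)) (OnE.rep-rotation∈ E∣b)
          (≡mod-reflexive (trans (lemma₂ a b c) (trans (cong (_+_ c) (sym k≡)) (lemma₃ (ι k) c))))
        where
        lemma₁ : ∀ c a → a ≡ (c + a) - c
        lemma₁ = solve-∀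
        lemma₂ : ∀ a b c → (c + a) + b ≡ c + (a + b)
        lemma₂ = solve-∀
        lemma₃ : ∀ k c → c + (k - c) ≡ k
        lemma₃ = solve-∀
      product⇐ {true , k} (inj₂ g∣k-c') with split g∣k-c'
      ... | a , b , D∣a , E∣b , k≡ =
        product-of false true (- a) (c' + b)
          (OnD.rep-rotation∈ (∣m⇒∣-m D∣a))
            (OnE.rep-reflection∈ {z = c' + b} (subst (+ E ∣_) (lemma₁ c' b) E∣b))
          (≡mod-reflexive (trans (lemma₂ a b c') (trans (cong (_+_ c') (sym k≡)) (lemma₃ (ι k) c'))))
        where
        lemma₁ : ∀ c' b → b ≡ (c' + b) - c'
        lemma₁ = solve-∀
        lemma₂ : ∀ a b c' → - - a + (c' + b) ≡ c' + (a + b)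
        lemma₂ = solve-∀
        lemma₃ : ∀ k c' → c' + (k - c') ≡ k
        lemma₃ = solve-∀

    -- ⟨a^D, b a^c⟩ and ⟨a^E, b a^c'⟩ permute iff gcd(D,E) ∣ 2(c' - c): the reflections of both
    -- products agree, and their rotations differ by the shift 2(c' - c).
    module Permutability {D E : ℕ} (D∣n : D ℕ.∣ n) (E∣n : E ℕ.∣ n) (c c' : ℤ) where

      g : ℕ
      g = gcd D E

      g∣D : + g ∣ + D
      g∣D = ∣ᵤ⇒∣ (gcd[m,n]∣m D E)

      g∣E : + g ∣ + E
      g∣E = ∣ᵤ⇒∣ (gcd[m,n]∣n D E)

      split-swapped : ∀ {z} → + g ∣ z → ∃₂ λ b a → (+ E ∣ b) × (+ D ∣ a) × (z ≡ b + a)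
      split-swapped g∣z with gcd-split D E g∣z
      ... | a , b , D∣a , E∣b , z≡ = b , a , E∣b , D∣a , trans z≡ (ℤP.+-comm a b)

      module AB = Product D∣n E∣n g∣D g∣E (gcd-split D E) c c'
      module BA = Product E∣n D∣n g∣E g∣D split-swapped c' c

      swap : ∀ c₁ c₂ → + g ∣ + 2 * (c₂ - c₁) →
        ∀ k → + g ∣ ι k - (c₂ - c₁) → + g ∣ ι k - (c₁ - c₂)
      swap c₁ c₂ g∣2δ k p = subst (+ g ∣_) (lemma (ι k) c₁ c₂) (∣m∣n⇒∣m+n p g∣2δ)
        where lemma : ∀ k c₁ c₂ → (k - (c₂ - c₁)) + + 2 * (c₂ - c₁) ≡ k - (c₁ - c₂)
              lemma = solve-∀

      permutes⇐ : + g ∣ + 2 * (c' - c) → T (permutes (Dih D c) (Dih E c'))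
      permutes⇐ g∣2δ = permutes⁺ (λ p → BA.product⇐ (AB→BA _ (AB.product⇒ p)))
        (λ p → AB.product⇐ (BA→AB _ (BA.product⇒ p)))
        where
        g∣2δ' : + g ∣ + 2 * (c - c')
        g∣2δ' = subst (+ g ∣_) (lemma c c') (∣m⇒∣-m g∣2δ)
          where lemma : ∀ c c' → - (+ 2 * (c' - c)) ≡ + 2 * (c - c')
                lemma = solve-∀
        AB→BA : ∀ x → AB.InAB x → BA.InAB x
        AB→BA (false , k) (inj₁ p) = inj₁ p
        AB→BA (false , k) (inj₂ p) = inj₂ (swap c c' g∣2δ k p)
        AB→BA (true  , k) (inj₁ p) = inj₂ p
        AB→BA (true  , k) (inj₂ p) = inj₁ p
        BA→AB : ∀ x → BA.InAB x → AB.InAB x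
        BA→AB (false , k) (inj₁ p) = inj₁ p
        BA→AB (false , k) (inj₂ p) = inj₂ (swap c' c g∣2δ' k p)
        BA→AB (true  , k) (inj₁ p) = inj₂ p
        BA→AB (true  , k) (inj₂ p) = inj₁ p


      -- a^(c' - c) lies in AB; in BA it forces g ∣ c' - c or g ∣ 2(c' - c).
      permutes⇒ : T (permutes (Dih D c) (Dih E c')) → + g ∣ + 2 * (c' - c)
      permutes⇒ perm = from-BA (BA.product⇒ (permutes⁻ perm (AB.product⇐ {x = shift} (inj₂ shift∈AB))))
        where
        shift : El n
        shift = (false , rep (c' - c))
        ι-shift : ι (rep (c' - c)) ≡ c' - c [mod + g ]
        ι-shift = ≡mod-weaken (∣-trans g∣D (Divisor.D∣N D∣n)) (ι-rep (c' - c))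
        shift∈AB : + g ∣ ι (rep (c' - c)) - (c' - c)
        shift∈AB = divides-difference ι-shift
        from-BA : BA.InAB shift → + g ∣ + 2 * (c' - c)
        from-BA (inj₁ g∣shift)    = ∣n⇒∣m*n (+ 2) (∣-resp-≡mod ι-shift g∣shift)
        from-BA (inj₂ g∣shift-δ') = subst (+ g ∣_) (lemma (ι (rep (c' - c))) c c')
          (∣m∣n⇒∣m-n g∣shift-δ' shift∈AB)
          where lemma : ∀ s c c' → (s - (c - c')) - (s - (c' - c)) ≡ + 2 * (c' - c)
                lemma = solve-∀

  range1⁻ : ∀ {j k} → j ∈ range1 k → 1 ≤ j × j ≤ k
  range1⁻ j∈ with ∈-map⁻ suc j∈
  ... | u , u∈ , refl = s≤s z≤n , ∈-upTo⁻ u∈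

  range1⁺ : ∀ {j k} → 1 ≤ j → j ≤ k → j ∈ range1 k
  range1⁺ {suc j} _ j≤k = ∈-map⁺ suc (∈-upTo⁺ j≤k)

  range1-unique : ∀ k → Unique (range1 k)
  range1-unique k = Unique.map⁺ ℕP.suc-injective (Unique.upTo⁺ k)

  allVecs-complete : ∀ k (v : Vec Bool k) → v ∈ allVecs k
  allVecs-complete zero    []          = here refl
  allVecs-complete (suc k) (false ∷ v) = ∈-concatMap⁺ (λ v → (false ∷ v) ∷ (true ∷ v) ∷ [])
    (lose (allVecs-complete k v) (here refl))
  allVecs-complete (suc k) (true  ∷ v) = ∈-concatMap⁺ (λ v → (false ∷ v) ∷ (true ∷ v) ∷ [])
    (lose (allVecs-complete k v) (there (here refl)))

  allVecs-unique : ∀ k → Unique (allVecs k)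
  allVecs-unique zero    = [] ∷ []
  allVecs-unique (suc k) = concatMap-unique Vec.tail (λ v → (false ∷ v) ∷ (true ∷ v) ∷ []) (allVecs-unique k)
    (λ v → ((λ ()) ∷ []) ∷ [] ∷ []) tail≡
    where
    tail≡ : ∀ v {z} → z ∈ (false ∷ v) ∷ (true ∷ v) ∷ [] → Vec.tail z ≡ v
    tail≡ v (here refl)         = refl
    tail≡ v (there (here refl)) = refl

  allSubs-complete : ∀ k (S : Sub k) → S ∈ allSubs k
  allSubs-complete k (u , v) = ∈-concatMap⁺ (λ u → map (u ,_) (allVecs k))
    (lose (allVecs-complete k u) (∈-map⁺ (u ,_) (allVecs-complete k v)))

  allSubs-unique : ∀ k → Unique (allSubs k)
  allSubs-unique k = concatMap-unique proj₁ (λ u → map (u ,_) (allVecs k)) (allVecs-unique k)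
    (λ u → Unique.map⁺ (cong proj₂) (allVecs-unique k)) proj₁≡
    where
    proj₁≡ : ∀ u {z} → z ∈ map (u ,_) (allVecs k) → proj₁ z ≡ u
    proj₁≡ u z∈ with ∈-map⁻ (u ,_) z∈
    ... | v , _ , refl = refl

  module Pairs (m : ℕ) where

    open Cofactor m

    block : ℕ → List (ℕ × ℕ)
    block s = if ⌊ s ℕ.∣? n ⌋ then map (s ,_) (range1 (divN n s)) else []

    block⁻ : ∀ {s p} → p ∈ block s → proj₁ p ≡ s × s ℕ.∣ n × proj₂ p ∈ range1 (divN n s)
    block⁻ {s} p∈ with s ℕ.∣? n
    ... | yes s∣n with ∈-map⁻ (s ,_) p∈
    ...   | j , j∈ , refl = refl , s∣n , j∈
    block⁻ {s} () | no _

    block-unique : ∀ s → Unique (block s)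
    block-unique s with s ℕ.∣? n
    ... | yes _ = Unique.map⁺ (cong proj₂) (range1-unique (divN n s))
    ... | no  _ = []

    record IsPair (s j : ℕ) : Set where
      field
        s∣n  : s ℕ.∣ n
        1≤j  : 1 ≤ j
        j≤n/s : j ≤ divN n s

    pairs⁻ : ∀ {s j} → (s , j) ∈ pairs n → IsPair s j
    pairs⁻ p∈ with find (∈-concatMap⁻ block {xs = range1 n} p∈)
    ... | s , _ , p∈s with block⁻ {s} p∈s
    ...   | refl , s∣n , j∈ = record { s∣n = s∣n ; 1≤j = proj₁ (range1⁻ j∈)
      ; j≤n/s = proj₂ (range1⁻ j∈) }

    pairs⁺ : ∀ {s j} → s ℕ.∣ n → 1 ≤ j → j ≤ divN n s → (s , j) ∈ pairs n
    pairs⁺ {s} {j} s∣n 1≤j j≤ =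
      ∈-concatMap⁺ block (lose (range1⁺ (divisor-pos s∣n) (ℕ.∣⇒≤ s∣n)) in-block)
      where
      in-block : (s , j) ∈ block s
      in-block with s ℕ.∣? n
      ... | yes _   = ∈-map⁺ (s ,_) (range1⁺ 1≤j j≤)
      ... | no  s∤n = ⊥-elim (s∤n s∣n)

    pairs-unique : Unique (pairs n)
    pairs-unique = concatMap-unique proj₁ block (range1-unique n) block-unique (λ s p∈ → proj₁ (block⁻ p∈))

  doubled-offset : ∀ {i j} → 1 ≤ i → 1 ≤ j → + 2 * (+ (j ℕ.∸ 1) - + (i ℕ.∸ 1)) ≡ - (+ 2 * (+ i - + j))
  doubled-offset {suc i} {suc j} _ _ = lemma (+ i) (+ j)
    where lemma : ∀ a b → + 2 * (b - a) ≡ - (+ 2 * ((+ 1 + a) - (+ 1 + b)))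
          lemma = solve-∀

  module Neighbours (m : ℕ) {r i : ℕ} (r∣n : r ℕ.∣ suc m) (1≤i : 1 ≤ i) (i≤ : i ≤ divN (suc m) r)
    where

    open Dihedral m
    open Cofactor m using (cofactor-∣; cofactor-pos; cofactor-involutive; cofactor-lcm)
    open Pairs m
    open Products m

    subgroupOf : ℕ × ℕ → Sub n
    subgroupOf (s , j) = Dih (divN n s) (+ (j ℕ.∸ 1))

    subgroupOf-injective : ∀ {p q} → p ∈ pairs n → q ∈ pairs n → subgroupOf p ≡ subgroupOf q → p ≡ q
    subgroupOf-injective {s , j} {s' , j'} p∈ q∈ same = cong₂ _,_ s≡s' j≡j'
      where
      module P = IsPair (pairs⁻ p∈)
      module Q = IsPair (pairs⁻ q∈)
      same-parameters : divN n s ≡ divN n s' × + divN n s ∣ + (j ℕ.∸ 1) - + (j' ℕ.∸ 1)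
      same-parameters = Dih-injective (cofactor-∣ P.s∣n) (cofactor-∣ Q.s∣n) same
      D≡D' : divN n s ≡ divN n s'
      D≡D' = proj₁ same-parameters
      s≡s' : s ≡ s'
      s≡s' = trans (sym (cofactor-involutive P.s∣n)) (trans (cong (divN n) D≡D') (cofactor-involutive Q.s∣n))
      pred-< : ∀ {a b} → 1 ≤ a → a ≤ b → a ℕ.∸ 1 < b
      pred-< {suc a} _ a≤b = a≤b
      j≡j' : j ≡ j'
      j≡j' = ℕP.∸-cancelʳ-≡ P.1≤j Q.1≤j (≡mod-small {D = divN n s} (pred-< P.1≤j P.j≤n/s)
        (pred-< Q.1≤j (subst (j' ≤_) (sym D≡D') Q.j≤n/s)) (cong-mod (proj₂ same-parameters)))

    H-is-subgroupOf : H n r i ≡ subgroupOf (r , i)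
    H-is-subgroupOf = generated-at r∣n i≤
      where
      generated-at : ∀ {r} → r ℕ.∣ n → i ≤ divN n r → H n r i ≡ subgroupOf (r , i)
      generated-at {zero}   0∣n _  = ⊥-elim (ℕP.0≢1+n (sym (ℕ.0∣⇒≡0 0∣n)))
      generated-at {suc r'} r∣n i≤ = Generation.generated-Dih m (cofactor-∣ r∣n) (i ℕ.∸ 1)
        (ℕP.≤-trans (ℕP.m∸n≤m i 1) (ℕP.≤-trans i≤ (ℕ.∣⇒≤ (cofactor-∣ r∣n))))

    Cond : ℕ × ℕ → Set
    Cond p = divN n (lcm r (proj₁ p)) ℕ.∣ ∣ + 2 * (+ i - + proj₂ p) ∣

    -- As a decision procedure this is literally the filter of x.
    cond? : ∀ p → Dec (Cond p)
    cond? p = divN n (lcm r (proj₁ p)) ℕ.∣? ∣ + 2 * (+ i - + proj₂ p) ∣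

    module Adjacency {s j : ℕ} (p∈ : (s , j) ∈ pairs n) where

      open IsPair (pairs⁻ p∈)
      open Permutability (cofactor-∣ r∣n) (cofactor-∣ s∣n) (+ (i ℕ.∸ 1)) (+ (j ℕ.∸ 1))

      gcd≡ : divN n (lcm r s) ≡ g
      gcd≡ = cofactor-lcm r∣n s∣n

      cond⇒permutes : Cond (s , j) → T (permutes (H n r i) (subgroupOf (s , j)))
      cond⇒permutes cond = subst (λ K → T (permutes K (subgroupOf (s , j)))) (sym H-is-subgroupOf) (permutes⇐
        (subst (+ g ∣_) (sym (doubled-offset 1≤i 1≤j)) (∣m⇒∣-m (∣ᵤ⇒∣ (subst (ℕ._∣ _) gcd≡ cond)))))

      permutes⇒cond : T (permutes (H n r i) (subgroupOf (s , j))) → Cond (s , j)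
      permutes⇒cond perm = subst (ℕ._∣ _) (sym gcd≡) (∣⇒∣ᵤ (subst (+ g ∣_) (ℤP.neg-involutive _)
        (∣m⇒∣-m (subst (+ g ∣_) (doubled-offset 1≤i 1≤j)
          (permutes⇒ (subst (λ K → T (permutes K (subgroupOf (s , j)))) H-is-subgroupOf perm))))))

    Neighbour : ℕ × ℕ → Set
    Neighbour p = (3 ≤ divN n (proj₁ p)) × (p ≢ (r , i)) × Cond p

    neighbour? : ∀ p → Dec (Neighbour p)
    neighbour? p = (3 ℕ.≤? divN n (proj₁ p)) ×-dec (¬? (ProductP.≡-dec ℕ._≟_ ℕ._≟_ p (r , i)))
      ×-dec cond? p

    IsNeighbour : Sub n → Set
    IsNeighbour K = T (isVertex K ∧ adjacent (H n r i) K)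

    H∈pairs : (r , i) ∈ pairs n
    H∈pairs = pairs⁺ r∣n 1≤i i≤

    neighbour⇐ : ∀ {p} → p ∈ pairs n → Neighbour p → IsNeighbour (subgroupOf p)
    neighbour⇐ {s , j} p∈ (3≤D , p≢H , cond) =
      T-∧⁺ (isVertex K) vertex (T-∧⁺ (not (eqSub (H n r i) K)) (T-not⁺ K≢H) (Adjacency.cond⇒permutes p∈ cond))
      where
      open IsPair (pairs⁻ p∈)
      open Divisor (cofactor-∣ s∣n)
      K : Sub n
      K = subgroupOf (s , j)
      c : ℤ
      c = + (j ℕ.∸ 1)
      D∤2 : ¬ (+ divN n s ∣ + 2)
      D∤2 D∣2 = ℕP.<⇒≱ 3≤D (ℕ.∣⇒≤ (∣⇒∣ᵤ D∣2))
      vertex : T (isVertex K)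
      vertex = T-∧⁺ (isSubgroup K) (isSubgroup⁺ (Dih-subgroup c))
        (T-∧⁺ (isProper K) (Dih-proper c (ℕP.≤-trans (s≤s (s≤s z≤n)) 3≤D)) (T-not⁺ (Dih-not-normal c D∤2)))
      K≢H : ¬ T (eqSub (H n r i) K)
      K≢H H≡K = p≢H (sym (subgroupOf-injective H∈pairs p∈ (trans (sym H-is-subgroupOf) (eqSub-sound H≡K))))

    record NeighbourFacts (K : Sub n) : Set where
      field
        laws       : SubgroupLaws K
        proper     : T (isProper K)
        non-normal : ¬ T (isNormal K)
        K≢H        : ¬ T (eqSub (H n r i) K)
        permutes-H : T (permutes (H n r i) K)

    neighbour-facts : ∀ K → IsNeighbour K → NeighbourFacts K
    neighbour-facts K t with T-∧⁻ (isVertex K) t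
    ... | vertex , adjacent-to-H with T-∧⁻ (isSubgroup K) vertex | T-∧⁻ (not (eqSub (H n r i) K)) adjacent-to-H
    ...   | subgroup , proper∧non-normal | K≢H , permutes-H with T-∧⁻ (isProper K) proper∧non-normal
    ...     | proper , non-normal = record
      { laws = subgroup-laws subgroup ; proper = proper ; non-normal = T-not⁻ non-normal
      ; K≢H = T-not⁻ K≢H ; permutes-H = permutes-H }

    -- Every neighbour K of H is the subgroup of a pair: being non-normal, K contains a
    -- reflection, so it is ⟨a^D, b a^c₀⟩ with D ∣ n, c₀ < D, and D ≥ 3.
    neighbour⇒ : ∀ K → IsNeighbour K → ∃ λ p → p ∈ pairs n × Neighbour p × K ≡ subgroupOf p
    neighbour⇒ K t = pair-of (Classification.dihedral-form m laws (proj₂ reflection))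
      where
      open NeighbourFacts (neighbour-facts K t)

      reflection : ∃ λ k → (true , k) ∈ₛ K
      reflection with FinP.any? (λ k → (true , k) ∈ₛ? K)
      ... | yes found = found
      ... | no  none  = ⊥-elim (non-normal (rotation-subgroup-normal laws (λ k k∈ → none (k , k∈))))

      pair-of : (∃₂ λ D c₀ → D ℕ.∣ n × c₀ < D × K ≡ Dih D (+ c₀)) →
        ∃ λ p → p ∈ pairs n × Neighbour p × K ≡ subgroupOf p
      pair-of (D , c₀ , D∣n , c₀<D , K≡Dih) = (s , suc c₀) , p∈ , (3≤n/s , p≢H , cond) , K≡
        where
        s : ℕ
        s = divN n D
        n/s≡D : divN n s ≡ D
        n/s≡D = cofactor-involutive D∣n
        K≡ : K ≡ subgroupOf (s , suc c₀)
        K≡ = trans K≡Dih (cong (λ E → Dih E (+ c₀)) (sym n/s≡D))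
        p∈ : (s , suc c₀) ∈ pairs n
        p∈ = pairs⁺ (cofactor-∣ D∣n) (s≤s z≤n) (subst (suc c₀ ≤_) (sym n/s≡D) c₀<D)
        3≤n/s : 3 ≤ divN n s
        3≤n/s = subst (3 ≤_) (sym n/s≡D)
          (Dih-index-≥3 D∣n (subst (λ K' → T (isProper K')) K≡Dih proper)
            (λ normal → non-normal (subst (λ K' → T (isNormal K')) (sym K≡Dih) normal)))
        p≢H : (s , suc c₀) ≢ (r , i)
        p≢H p≡H = K≢H (subst (λ K' → T (eqSub (H n r i) K'))
          (trans H-is-subgroupOf (trans (cong subgroupOf (sym p≡H)) (sym K≡)))
                    (eqSub-refl (H n r i)))
        cond : Cond (s , suc c₀)
        cond = Adjacency.permutes⇒cond p∈ (subst (λ K' → T (permutes (H n r i) K')) K≡ permutes-H)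

    degree≡ : degΓN n (H n r i) ≡ length (filter neighbour? (pairs n))
    degree≡ = length-filter-image neighbour? (λ K → T? (isVertex K ∧ adjacent (H n r i) K)) subgroupOf
      pairs-unique (allSubs-unique n) (allSubs-complete n) subgroupOf-injective (λ {K} → neighbour⇒ K) neighbour⇐

    cond-of-normal : ∀ {s j} → s ℕ.∣ n → divN n s ℕ.∣ 2 → Cond (s , j)
    cond-of-normal {s} {j} s∣n D∣2 = subst (ℕ._∣ _) (sym (cofactor-lcm r∣n s∣n))
      (ℕ.∣-trans (gcd[m,n]∣n (divN n r) (divN n s))
        (ℕ.∣-trans D∣2 (∣⇒∣ᵤ (∣m⇒∣m*n (+ i - + j) (∣-refl {+ 2})))))

    not-neighbour : ∀ {p} → divN n (proj₁ p) ≤ 2 → ¬ Neighbour p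
    not-neighbour D≤2 (3≤D , _) = ℕP.<⇒≱ 3≤D D≤2

    cond-H : Cond (r , i)
    cond-H = subst (λ z → divN n (lcm r r) ℕ.∣ ∣ + 2 * z ∣) (sym (ℤP.+-inverseʳ (+ i)))
      (divN n (lcm r r) ℕ.∣0)

    exception-cases : ∀ {p} → Cond p → ¬ Neighbour p → p ≡ (r , i) ⊎ divN n (proj₁ p) ≤ 2
    exception-cases {p} cond ¬neighbour
      with ProductP.≡-dec ℕ._≟_ ℕ._≟_ p (r , i) | 3 ℕ.≤? divN n (proj₁ p)
    ... | yes p≡H | _      = inj₁ p≡H
    ... | no  p≢H | yes 3≤ = ⊥-elim (¬neighbour (3≤ , p≢H , cond))
    ... | no  _   | no  3≰ = inj₂ (ℕP.≤-pred (ℕP.≰⇒> 3≰))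

    SmallPair : ℕ × ℕ → Set
    SmallPair p = p ≡ (n , 1) ⊎ (2 ℕ.∣ n × (p ≡ (divN n 2 , 1) ⊎ p ≡ (divN n 2 , 2)))

    small-pairs : ∀ {s j} → (s , j) ∈ pairs n → divN n s ≤ 2 → SmallPair (s , j)
    small-pairs {s} {j} p∈ D≤2 = cases (divN n s) refl D≤2 (cofactor-pos s∣n)
      where
      open IsPair (pairs⁻ p∈)
      s≡ : ∀ {D} → divN n s ≡ D → s ≡ divN n D
      s≡ D≡ = trans (sym (cofactor-involutive s∣n)) (cong (divN n) D≡)
      cases : ∀ D → divN n s ≡ D → D ≤ 2 → 1 ≤ D → SmallPair (s , j)
      cases (suc zero) D≡ _ _ = inj₁ (cong₂ _,_ (trans (s≡ D≡) (n/1≡n n))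
        (ℕP.≤-antisym (subst (j ≤_) D≡ j≤n/s) 1≤j))
      cases (suc (suc zero)) D≡ _ _ = inj₂ (subst (ℕ._∣ n) D≡ (cofactor-∣ s∣n) ,
        one-or-two j 1≤j (subst (j ≤_) D≡ j≤n/s))
        where
        one-or-two : ∀ j → 1 ≤ j → j ≤ 2 → (s , j) ≡ (divN n 2 , 1) ⊎ (s , j) ≡ (divN n 2 , 2)
        one-or-two (suc zero)       _ _ = inj₁ (cong (_, 1) (s≡ D≡))
        one-or-two (suc (suc zero)) _ _ = inj₂ (cong (_, 2) (s≡ D≡))
        one-or-two (suc (suc (suc _))) _ (s≤s (s≤s ()))
      cases (suc (suc (suc _))) _ (s≤s (s≤s ())) _

    counting : ∀ {E} → Unique E → (∀ {p} → p ∈ E → p ∈ pairs n × Cond p × ¬ Neighbour p) →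
      (∀ {p} → p ∈ pairs n → Cond p → ¬ Neighbour p → p ∈ E) → degΓN n (H n r i) ℕ.+ length E ≡ x n r i
    counting {E} uE exceptional exception = trans (cong (ℕ._+ length E) degree≡)
      (sym (length-filter-split cond? neighbour? pairs-unique uE
        (λ _ neighbour → proj₂ (proj₂ neighbour)) exception exceptional))

    H-exceptional : (r , i) ∈ pairs n × Cond (r , i) × ¬ Neighbour (r , i)
    H-exceptional = H∈pairs , cond-H , λ neighbour → proj₁ (proj₂ neighbour) refl

    whole-exceptional : (n , 1) ∈ pairs n × Cond (n , 1) × ¬ Neighbour (n , 1)
    whole-exceptional = pairs⁺ ℕ.∣-refl ℕP.≤-refl (subst (1 ≤_) (sym n/n≡1′) ℕP.≤-refl) ,
      cond-of-normal {j = 1} ℕ.∣-refl (subst (ℕ._∣ 2) (sym n/n≡1′) (ℕ.1∣ 2)) ,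
        not-neighbour (subst (_≤ 2) (sym n/n≡1′) (s≤s z≤n))
      where
      n/n≡1′ : divN n n ≡ 1
      n/n≡1′ = n/n≡1 n

    half-exceptional : 2 ℕ.∣ n → ∀ j → 1 ≤ j → j ≤ 2 →
      (divN n 2 , j) ∈ pairs n × Cond (divN n 2 , j) × ¬ Neighbour (divN n 2 , j)
    half-exceptional 2∣n j 1≤j j≤2 = pairs⁺ (cofactor-∣ 2∣n) 1≤j (subst (j ≤_) (sym n/[n/2]≡2) j≤2) ,
      cond-of-normal {j = j} (cofactor-∣ 2∣n) (subst (ℕ._∣ 2) (sym n/[n/2]≡2) ℕ.∣-refl) ,
        not-neighbour (subst (_≤ 2) (sym n/[n/2]≡2) ℕP.≤-refl)
      where
      n/[n/2]≡2 : divN n (divN n 2) ≡ 2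
      n/[n/2]≡2 = cofactor-involutive 2∣n

    odd-degree : ¬ 2 ℕ.∣ n → r ≢ n → degΓN n (H n r i) ℕ.+ 2 ≡ x n r i
    odd-degree n-odd r≢n = counting {E} ((r≢ ∷ []) ∷ [] ∷ []) exceptional exception
      where
      E : List (ℕ × ℕ)
      E = (r , i) ∷ (n , 1) ∷ []
      r≢ : (r , i) ≢ (n , 1)
      r≢ e = r≢n (cong proj₁ e)
      exceptional : ∀ {p} → p ∈ E → p ∈ pairs n × Cond p × ¬ Neighbour p
      exceptional (here refl)         = H-exceptional
      exceptional (there (here refl)) = whole-exceptional
      exception : ∀ {p} → p ∈ pairs n → Cond p → ¬ Neighbour p → p ∈ E
      exception {s , j} p∈ cond ¬neighbour with exception-cases cond ¬neighbour
      ... | inj₁ refl = here refl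
      ... | inj₂ D≤2 with small-pairs p∈ D≤2
      ...   | inj₁ refl       = there (here refl)
      ...   | inj₂ (2∣n , _)  = ⊥-elim (n-odd 2∣n)

    even-degree : 2 ℕ.∣ n → r ≢ n → r ≢ divN n 2 → degΓN n (H n r i) ℕ.+ 4 ≡ x n r i
    even-degree 2∣n r≢n r≢n/2 = counting {E} distinct exceptional exception
      where
      h : ℕ
      h = divN n 2
      E : List (ℕ × ℕ)
      E = (r , i) ∷ (n , 1) ∷ (h , 1) ∷ (h , 2) ∷ []
      h≢n : h ≢ n
      h≢n = ℕP.<⇒≢ (m/n<m n 2 (s≤s (s≤s z≤n)))
      distinct : Unique E
      distinct = ((λ e → r≢n (cong proj₁ e)) ∷ (λ e → r≢n/2 (cong proj₁ e))
        ∷ (λ e → r≢n/2 (cong proj₁ e)) ∷ [])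
               ∷ ((λ e → h≢n (sym (cong proj₁ e))) ∷ (λ e → h≢n (sym (cong proj₁ e))) ∷ [])
               ∷ ((λ ()) ∷ [])
               ∷ [] ∷ []
      exceptional : ∀ {p} → p ∈ E → p ∈ pairs n × Cond p × ¬ Neighbour p
      exceptional (here refl)                         = H-exceptional
      exceptional (there (here refl))                 = whole-exceptional
      exceptional (there (there (here refl)))         = half-exceptional 2∣n 1 ℕP.≤-refl (s≤s z≤n)
      exceptional (there (there (there (here refl)))) = half-exceptional 2∣n 2 (s≤s z≤n) ℕP.≤-refl
      exception : ∀ {p} → p ∈ pairs n → Cond p → ¬ Neighbour p → p ∈ E
      exception {s , j} p∈ cond ¬neighbour with exception-cases cond ¬neighbour
      ... | inj₁ refl = here refl
      ... | inj₂ D≤2 with small-pairs p∈ D≤2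
      ...   | inj₁ refl              = there (here refl)
      ...   | inj₂ (_ , inj₁ refl)   = there (there (here refl))
      ...   | inj₂ (_ , inj₂ refl)   = there (there (there (here refl)))

open Development using (module Neighbours)

open import Defs
open import Data.Nat using (ℕ; zero; suc; _+_; _≤_; NonZero)
open import Data.Nat.DivMod using (_/_)
open import Data.Nat.Divisibility using (_∣_)
open import Data.Product using (_×_; _,_)
open import Relation.Nullary using (¬_)
open import Relation.Binary.PropositionalEquality using (_≡_; _≢_)

-- Theorem 4.1.  For n = m + 1 and r = r' + 1 the quotient n / r is the cofactor divN n r,
-- and the two parts are odd-degree and even-degree of Neighbours.
theorem4p1 : (n : ℕ) → 3 ≤ n →
    ((¬ (2 ∣ n)) → (r : ℕ) → .{{_ : NonZero r}} → r ∣ n → r ≢ n →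
      (i : ℕ) → 1 ≤ i → i ≤ n / r → degΓN n (H n r i) + 2 ≡ x n r i)
    × ((2 ∣ n) → (r : ℕ) → .{{_ : NonZero r}} → r ∣ n → r ≢ n → r ≢ n / 2 →
      (i : ℕ) → 1 ≤ i → i ≤ n / r → degΓN n (H n r i) + 4 ≡ x n r i)
theorem4p1 zero    ()
theorem4p1 (suc m) _ = odd-case , even-case
  where
  odd-case : ¬ (2 ∣ suc m) → (r : ℕ) → .{{_ : NonZero r}} → r ∣ suc m → r ≢ suc m →
    (i : ℕ) → 1 ≤ i → i ≤ suc m / r → degΓN (suc m) (H (suc m) r i) + 2 ≡ x (suc m) r i
  odd-case n-odd (suc r') r∣n r≢n i 1≤i i≤n/r =
    Neighbours.odd-degree m r∣n 1≤i i≤n/r n-odd r≢n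
  even-case : 2 ∣ suc m → (r : ℕ) → .{{_ : NonZero r}} → r ∣ suc m → r ≢ suc m → r ≢ suc m / 2 →
    (i : ℕ) → 1 ≤ i → i ≤ suc m / r → degΓN (suc m) (H (suc m) r i) + 4 ≡ x (suc m) r i
  even-case n-even (suc r') r∣n r≢n r≢n/2 i 1≤i i≤n/r =
    Neighbours.even-degree m r∣n 1≤i i≤n/r n-even r≢n r≢n/2
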